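{- Let $r,p\ge1$, $\bm{x}_1,\ldots,\bm{x}_r\in\mathbb{C}^p$ and $t_1,\ldots,t_{p-1}\in\mathbb{C}\setminus\{0,-1,-2,\ldots\}$. Then for all $n_1,\ldots,n_r,k_1,\ldots,k_r\in\mathbb{N}$, $$(\Delta_1^{k_1}\cdots\Delta_r^{k_r}c^{t_1,\ldots,t_{p-1}}_{\bm{x}_1;\cdots;\bm{x}_r})(n_1,\ldots,n_r)=c^{t_1,\ldots,t_{p-1}}_{\bm{x}_1;\cdots;\bm{x}_r;\bm{1}-\bm{x}_1;\cdots;\bm{1}-\bm{x}_r}(n_1,\ldots,n_r,k_1,\ldots,k_r),$$ where $\bm{1}-\bm{x}=(1-x_1,\ldots,1-x_p)$ for $\bm{x}=(x_1,\ldots,x_p)$, and the right-hand side is the nested sum with $2r$ parameter vectors.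
   Context: $\mathbb{N}=\{0,1,2,\ldots\}$; $0^0=1$. For complex $z$ and $m\in\mathbb{N}$, $\binom{z}{m}=z(z-1)\cdots(z-m+1)/m!$; multinomial coefficients are $\binom{n}{\nu_1,\ldots,\nu_p}=n!/(\nu_1!\cdots\nu_p!)$. For any $s\ge1$, vectors $\bm{y}_i=(y_{i1},\ldots,y_{ip})\in\mathbb{C}^p$ ($1\le i\le s$) and $m_1,\ldots,m_s\in\mathbb{N}$, define $$c^{t_1,\ldots,t_{p-1}}_{\bm{y}_1;\cdots;\bm{y}_s}(m_1,\ldots,m_s)=\sum\frac{\prod_{i=1}^s\binom{m_i}{\nu_{i1},\ldots,\nu_{ip}}y_{i1}^{\nu_{i1}}\cdots y_{ip}^{\nu_{ip}}}{\prod_{j=1}^{p-1}\binom{m_{1j}+\cdots+m_{sj}+t_j-1}{\nu_{1j}+\cdots+\nu_{sj}}(m_{1j}+\cdots+m_{sj}+t_j)},$$ summing over all integers $m_{ij}$ with $m_i=m_{i1}\ge m_{i2}\ge\cdots\ge m_{ip}\ge0$ for each $i$, where $\nu_{ij}=m_{ij}-m_{i,j+1}$ for $j<p$ and $\nu_{ip}=m_{ip}$. For a sequence $a\colon\mathbb{N}^r\to\mathbb{C}$ and $1\le i\le r$, $(\Delta_i a)(n_1,\ldots,n_r)=a(n_1,\ldots,n_r)-a(n_1,\ldots,n_i+1,\ldots,n_r)$, and $\Delta_1^{k_1}\cdots\Delta_r^{k_r}$ is the composite with $\Delta_i$ applied $k_i$ times. -}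

module Defs where

open import Level using (Level; _⊔_) renaming (suc to lsuc)
open import Algebra.Bundles using (CommutativeRing)
open import Data.Nat as ℕ using (ℕ; zero; suc; _∸_; _!; NonZero)
open import Data.Nat.Properties using (_!≢0; m*n≢0)
open import Data.Nat.DivMod using (_/_)
open import Data.Fin as Fin using (Fin; inject₁; zero; suc)
open import Data.List as List using (List; []; _∷_; concatMap; upTo)
import Data.Vec.Functional as V
open import Relation.Nullary using (¬_)
open import Function using (_∘_; id)

prodℕ : ∀ {n} → (Fin n → ℕ) → ℕ
prodℕ {zero}  f = 1
prodℕ {suc n} f = f zero ℕ.* prodℕ (λ j → f (suc j))

prod!≢0 : ∀ {n} (f : Fin n → ℕ) → NonZero (prodℕ (λ j → f j !))
prod!≢0 {zero}  f = _
prod!≢0 {suc n} f = m*n≢0 (f zero !) _ {{f zero !≢0}} {{prod!≢0 (λ j → f (suc j))}}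

multinomial : ∀ {p} → ℕ → (Fin p → ℕ) → ℕ
multinomial m ν = (m ! / prodℕ (λ j → ν j !)) {{prod!≢0 ν}}

-- for a chain c = (c_1,…,c_p), next c j = c_{j+1} (and c_{p+1} = 0)
next : ∀ {q} → (Fin (suc q) → ℕ) → Fin (suc q) → ℕ
next {zero}  c zero    = 0
next {suc q} c zero    = c (suc zero)
next {suc q} c (suc j) = next (λ k → c (suc k)) j

nu : ∀ {q} → (Fin (suc q) → ℕ) → Fin (suc q) → ℕ
nu c j = c j ∸ next c j

-- all chains m = c_1 ≥ c_2 ≥ ⋯ ≥ c_{q+1} ≥ 0
chainsFrom : (q : ℕ) → ℕ → List (Fin (suc q) → ℕ)
chainsFrom zero    m = (λ _ → m) ∷ []
chainsFrom (suc q) m =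
  concatMap (λ m' → List.map (λ c → m V.∷ c) (chainsFrom q m')) (upTo (suc m))

chainTuples : (q s : ℕ) → (Fin s → ℕ) → List (Fin s → Fin (suc q) → ℕ)
chainTuples q zero    ms = (λ ()) ∷ []
chainTuples q (suc s) ms =
  concatMap (λ c → List.map (λ cs → c V.∷ cs) (chainTuples q s (V.tail ms)))
            (chainsFrom q (V.head ms))

iter : ∀ {a} {A : Set a} → (A → A) → ℕ → A → A
iter f zero    x = x
iter f (suc n) x = f (iter f n x)

-- Fields of characteristic zero (ℂ is one)

module _ {c ℓ} (R : CommutativeRing c ℓ) where
  open CommutativeRing R hiding (zero)

  ι : ℕ → Carrier
  ι zero    = 0#
  ι (suc n) = 1# + ι n

record CharZeroField (c ℓ : Level) : Set (lsuc (c ⊔ ℓ)) where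
  field
    commutativeRing : CommutativeRing c ℓ
  open CommutativeRing commutativeRing hiding (zero)
  field
    _⁻¹       : Carrier → Carrier
    ⁻¹-inverse : ∀ x → ¬ (x ≈ 0#) → x * (x ⁻¹) ≈ 1#
    charZero   : ∀ n → ¬ (ι commutativeRing (suc n) ≈ 0#)
  open CommutativeRing commutativeRing public hiding (zero)

module FieldDefs {c ℓ} (F : CharZeroField c ℓ) where
  open CharZeroField F

  ιF : ℕ → Carrier
  ιF = ι commutativeRing

  pow : Carrier → ℕ → Carrier
  pow x zero    = 1#
  pow x (suc n) = x * pow x n

  prodF : ∀ {n} → (Fin n → Carrier) → Carrier
  prodF {zero}  f = 1#
  prodF {suc n} f = f zero * prodF (λ j → f (suc j))

  sumℕF : ∀ {n} → (Fin n → ℕ) → ℕ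
  sumℕF {zero}  f = 0
  sumℕF {suc n} f = f zero ℕ.+ sumℕF (λ j → f (suc j))

  sumL : List Carrier → Carrier
  sumL = List.foldr _+_ 0#

  falling : Carrier → ℕ → Carrier
  falling z zero    = 1#
  falling z (suc m) = falling z m * (z - ιF m)

  binom : Carrier → ℕ → Carrier
  binom z m = falling z m * (ιF (m !) ⁻¹)

  oneMinus : ∀ {p} → (Fin p → Carrier) → Fin p → Carrier
  oneMinus x j = 1# - x j

  -- the summand for a given s-tuple of chains cs (cs i j = m_{i,j+1})
  summand : ∀ {q s} → (Fin q → Carrier) → (Fin s → Fin (suc q) → Carrier)
          → (Fin s → Fin (suc q) → ℕ) → Carrier
  summand {q} {s} t ys cs = numer * (denom ⁻¹)
    where
    numer : Carrier
    numer = prodF (λ i → ιF (multinomial (cs i zero) (nu (cs i)))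
                        * prodF (λ j → pow (ys i j) (nu (cs i) j)))
    M : Fin q → ℕ
    M j = sumℕF (λ i → cs i (inject₁ j))
    N : Fin q → ℕ
    N j = sumℕF (λ i → nu (cs i) (inject₁ j))
    denom : Carrier
    denom = prodF (λ j → binom (ιF (M j) + t j - 1#) (N j) * (ιF (M j) + t j))

  -- c^{t_1,…,t_{p-1}}_{y_1;…;y_s}(m_1,…,m_s), with p = suc q
  cSeq : ∀ {q s} → (Fin q → Carrier) → (Fin s → Fin (suc q) → Carrier)
       → (Fin s → ℕ) → Carrier
  cSeq {q} {s} t ys ms = sumL (List.map (summand t ys) (chainTuples q s ms))

  Δ : ∀ {r} → Fin r → ((Fin r → ℕ) → Carrier) → (Fin r → ℕ) → Carrier
  Δ i a n = a n - a (V.updateAt n i suc)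

  Δs : ∀ {r} → (Fin r → ℕ) → ((Fin r → ℕ) → Carrier) → (Fin r → ℕ) → Carrier
  Δs k = V.foldr (λ f g → f ∘ g) id (λ i → iter (Δ i) (k i))

-- Write H(n, K) for the c-sequence with parameter vectors x and 1 - x evaluated at (n, K).
-- Raising the length of row i of a chain tuple amounts to choosing which part νᵢⱼ grows, so
-- c(m + eᵢ) = Σⱼ yᵢⱼ cⱼ(m), where cⱼ has its denominator evaluated at shifted column sums. The
-- partial-fraction identity Σⱼ 1/D(M + 1_{≤j}, N + eⱼ) = 1/D(M, N) then gives
-- c(m) = c(m + eᵢ) + c(m + eᵢ') whenever the rows i and i' have parameters adding up to 1.
-- For the rows xᵢ and 1 - xᵢ this says H(n, K) = H(n + eᵢ, K) + H(n, K + eᵢ), that is,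
-- Δᵢ H(·, K) = H(·, K + eᵢ); iterating from H(·, 0) = c_x (empty rows contribute nothing)
-- gives the claim.

module Submission where

open import Defs
open import Algebra.Bundles using (CommutativeRing)
open import Algebra.Solver.Ring.AlmostCommutativeRing using (fromCommutativeRing; _-Raw-AlmostCommutative⟶_)
import Algebra.Solver.Ring as RingSolver
open import Data.Nat as ℕ using (ℕ; zero; suc; _≤_; _<_; z≤n; s≤s; _∸_; _!; NonZero)
import Data.Nat.Properties as ℕP
open import Data.Nat.DivMod using (_/_; m*n/n≡m; m/n*n≡m)
open import Data.Nat.Combinatorics using (_C_; nCk≡n!/k![n-k]!; k![n∸k]!∣n!; nCk+nC[k+1]≡[n+1]C[k+1]; k>n⇒nCk≡0)
open import Data.Nat.Solver using (module +-*-Solver)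
open import Data.Integer as ℤ using (ℤ; -[1+_])
import Data.Integer.Properties as ℤP
open import Data.Sign as Sign using (Sign)
open import Data.Fin as Fin using (Fin; zero; suc; toℕ; inject₁; _↑ˡ_; _↑ʳ_; splitAt)
import Data.Fin.Properties as FinP
open import Data.Maybe using (Maybe; just; nothing)
open import Data.Sum using (inj₁; inj₂)
open import Data.List as List using (List; []; _∷_; concatMap; upTo; applyUpTo)
open import Data.List.Relation.Unary.All as All using (All; []; _∷_)
import Data.List.Relation.Unary.All.Properties as AllP
import Data.Vec.Functional as V
open import Data.Vec.Functional using (_++_)
open import Data.Vec.Functional.Properties using (lookup-++ˡ; lookup-++ʳ; ++-cong)
open import Data.Vec.Functional.Relation.Binary.Pointwise using (Pointwise)
open import Function using (_∘_; id)
open import Relation.Nullary using (¬_; yes; no)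
import Relation.Binary.PropositionalEquality as ≡
open ≡ using (_≡_; _≗_)
open import Algebra.Properties.CommutativeMonoid.Sum ℕP.+-0-commutativeMonoid using () renaming (sum to sumᴺ; sum-replicate-zero to sumᴺ-replicate-zero)

m≡n*o⇒m/o≡n : ∀ {m n o} .{{_ : NonZero o}} → m ≡ n ℕ.* o → m / o ≡ n
m≡n*o⇒m/o≡n {n = n} {o} ≡.refl = m*n/n≡m n o

nCk*[k!*[n∸k]!]≡n! : ∀ {n k} → k ≤ n → (n C k) ℕ.* (k ! ℕ.* (n ∸ k) !) ≡ n !
nCk*[k!*[n∸k]!]≡n! {n} {k} k≤n =
  ≡.trans (≡.cong (ℕ._* (k ! ℕ.* (n ∸ k) !)) (nCk≡n!/k![n-k]! k≤n)) (m/n*n≡m (k![n∸k]!∣n! k≤n))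
  where instance
    _ : NonZero (k ! ℕ.* (n ∸ k) !)
    _ = ℕP.m*n≢0 (k !) ((n ∸ k) !) {{k ℕP.!≢0}} {{(n ∸ k) ℕP.!≢0}}

multinomial≡1 : ∀ {p} m (ν : Fin p → ℕ) → prodℕ (λ j → ν j !) ≡ m ! → multinomial m ν ≡ 1
multinomial≡1 m ν eq = m≡n*o⇒m/o≡n {{prod!≢0 ν}} (≡.trans (≡.sym eq) (≡.sym (ℕP.*-identityˡ _)))

IsChain : ∀ {q} → (Fin (suc q) → ℕ) → Set
IsChain c = ∀ k → next c k ≤ c k

-- multinomial is defined by truncated division; this records that the division is exact.
MultinomialExact : ∀ {q} → (Fin (suc q) → ℕ) → Set
MultinomialExact c = prodℕ (λ j → nu c j !) ℕ.* multinomial (c zero) (nu c) ≡ c zero !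

record ChainFrom {q} (m : ℕ) (c : Fin (suc q) → ℕ) : Set where
  constructor chainFrom
  field
    head≡ : c zero ≡ m
    isChain : IsChain c
    exact : MultinomialExact c

module _ {q} (m : ℕ) (c : Fin (suc q) → ℕ) (c₀≤m : c zero ≤ m) (exact : MultinomialExact c) where
  open ≡.≡-Reasoning
  open +-*-Solver

  private
    μ P : ℕ
    μ = multinomial (c zero) (nu c)
    P = prodℕ (λ j → nu c j !)

    m!≡ : m ! ≡ ((m C c zero) ℕ.* μ) ℕ.* ((m ∸ c zero) ! ℕ.* P)
    m!≡ = begin
      m !                                             ≡⟨ nCk*[k!*[n∸k]!]≡n! c₀≤m ⟨
      (m C c zero) ℕ.* (c zero ! ℕ.* (m ∸ c zero) !)  ≡⟨ ≡.cong (λ x → (m C c zero) ℕ.* (x ℕ.* (m ∸ c zero) !)) exact ⟨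
      (m C c zero) ℕ.* ((P ℕ.* μ) ℕ.* (m ∸ c zero) !) ≡⟨ solve 4 (λ a b x y → a :* ((y :* b) :* x) := (a :* b) :* (x :* y)) ≡.refl (m C c zero) μ ((m ∸ c zero) !) P ⟩
      ((m C c zero) ℕ.* μ) ℕ.* ((m ∸ c zero) ! ℕ.* P) ∎

  multinomial-∷ : multinomial m (nu (m V.∷ c)) ≡ (m C c zero) ℕ.* μ
  multinomial-∷ = m≡n*o⇒m/o≡n {{prod!≢0 (nu (m V.∷ c))}} m!≡

  multinomialExact-∷ : MultinomialExact (m V.∷ c)
  multinomialExact-∷ = begin
    ((m ∸ c zero) ! ℕ.* P) ℕ.* multinomial m (nu (m V.∷ c)) ≡⟨ ≡.cong (((m ∸ c zero) ! ℕ.* P) ℕ.*_) multinomial-∷ ⟩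
    ((m ∸ c zero) ! ℕ.* P) ℕ.* ((m C c zero) ℕ.* μ)         ≡⟨ ℕP.*-comm ((m ∸ c zero) ! ℕ.* P) ((m C c zero) ℕ.* μ) ⟩
    ((m C c zero) ℕ.* μ) ℕ.* ((m ∸ c zero) ! ℕ.* P)         ≡⟨ m!≡ ⟨
    m ! ∎

chainsFrom-chains : ∀ q m → All (ChainFrom m) (chainsFrom q m)
chainsFrom-chains zero m = chainFrom ≡.refl (λ { zero → z≤n }) exact ∷ []
  where
  exact : MultinomialExact {zero} (λ _ → m)
  exact = begin
    (m ! ℕ.* 1) ℕ.* multinomial m (nu {zero} (λ _ → m)) ≡⟨ ≡.cong ((m ! ℕ.* 1) ℕ.*_) (multinomial≡1 m (nu {zero} (λ _ → m)) (ℕP.*-identityʳ (m !))) ⟩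
    (m ! ℕ.* 1) ℕ.* 1                                   ≡⟨ ℕP.*-identityʳ (m ! ℕ.* 1) ⟩
    m ! ℕ.* 1                                           ≡⟨ ℕP.*-identityʳ (m !) ⟩
    m ! ∎
    where open ≡.≡-Reasoning
chainsFrom-chains (suc q) m = AllP.concat⁺ (AllP.map⁺ (AllP.applyUpTo⁺₁ _ (suc m) (λ m'<1+m →
  AllP.map⁺ (All.map (cons (ℕP.<⇒≤pred m'<1+m)) (chainsFrom-chains q _)))))
  where
  cons : ∀ {m'} {c : Fin (suc q) → ℕ} → m' ≤ m → ChainFrom m' c → ChainFrom m (m V.∷ c)
  cons {c = c} m'≤m (chainFrom ≡.refl chain exact) = chainFrom ≡.refl (λ { zero → m'≤m ; (suc k) → chain k }) (multinomialExact-∷ m c m'≤m exact)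

raiseUpTo : ∀ {p n} → Fin (suc p) → (Fin n → ℕ) → Fin n → ℕ
raiseUpTo {n = zero}          j       v = v
raiseUpTo {n = suc n}         zero    v = suc (V.head v) V.∷ V.tail v
raiseUpTo {suc p} {n = suc n} (suc j) v = suc (V.head v) V.∷ raiseUpTo j (V.tail v)

raiseAt : ∀ {p n} → Fin p → (Fin n → ℕ) → Fin n → ℕ
raiseAt {n = zero}  j       v = v
raiseAt {n = suc n} zero    v = suc (V.head v) V.∷ V.tail v
raiseAt {n = suc n} (suc j) v = V.head v V.∷ raiseAt j (V.tail v)

raiseUpTo-zero : ∀ {p n} (j : Fin (suc p)) (v : Fin (suc n) → ℕ) → raiseUpTo j v zero ≡ suc (v zero)
raiseUpTo-zero         zero    v = ≡.refl
raiseUpTo-zero {suc _} (suc j) v = ≡.refl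

raiseUpTo-+ˡ : ∀ {p n} (j : Fin (suc p)) (a b : Fin n → ℕ) k → raiseUpTo j (λ k → a k ℕ.+ b k) k ≡ raiseUpTo j a k ℕ.+ b k
raiseUpTo-+ˡ         zero    a b zero    = ≡.refl
raiseUpTo-+ˡ {suc _} (suc j) a b zero    = ≡.refl
raiseUpTo-+ˡ         zero    a b (suc k) = ≡.refl
raiseUpTo-+ˡ {suc _} (suc j) a b (suc k) = raiseUpTo-+ˡ j (V.tail a) (V.tail b) k

raiseUpTo-+ʳ : ∀ {p n} (j : Fin (suc p)) (a b : Fin n → ℕ) k → raiseUpTo j (λ k → a k ℕ.+ b k) k ≡ a k ℕ.+ raiseUpTo j b k
raiseUpTo-+ʳ         zero    a b zero    = ≡.sym (ℕP.+-suc (a zero) (b zero))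
raiseUpTo-+ʳ {suc _} (suc j) a b zero    = ≡.sym (ℕP.+-suc (a zero) (b zero))
raiseUpTo-+ʳ         zero    a b (suc k) = ≡.refl
raiseUpTo-+ʳ {suc _} (suc j) a b (suc k) = raiseUpTo-+ʳ j (V.tail a) (V.tail b) k

raiseAt-+ˡ : ∀ {p n} (j : Fin p) (a b : Fin n → ℕ) k → raiseAt j (λ k → a k ℕ.+ b k) k ≡ raiseAt j a k ℕ.+ b k
raiseAt-+ˡ zero    a b zero    = ≡.refl
raiseAt-+ˡ zero    a b (suc k) = ≡.refl
raiseAt-+ˡ (suc j) a b zero    = ≡.refl
raiseAt-+ˡ (suc j) a b (suc k) = raiseAt-+ˡ j (V.tail a) (V.tail b) k

raiseAt-+ʳ : ∀ {p n} (j : Fin p) (a b : Fin n → ℕ) k → raiseAt j (λ k → a k ℕ.+ b k) k ≡ a k ℕ.+ raiseAt j b k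
raiseAt-+ʳ zero    a b zero    = ≡.sym (ℕP.+-suc (a zero) (b zero))
raiseAt-+ʳ zero    a b (suc k) = ≡.refl
raiseAt-+ʳ (suc j) a b zero    = ≡.refl
raiseAt-+ʳ (suc j) a b (suc k) = raiseAt-+ʳ j (V.tail a) (V.tail b) k

raiseAt≤raiseUpTo : ∀ {p n} (j : Fin (suc p)) {N M : Fin n → ℕ} → Pointwise _≤_ N M → Pointwise _≤_ (raiseAt j N) (raiseUpTo j M)
raiseAt≤raiseUpTo         zero    N≤M zero    = s≤s (N≤M zero)
raiseAt≤raiseUpTo         zero    N≤M (suc k) = N≤M (suc k)
raiseAt≤raiseUpTo {suc _} (suc j) N≤M zero    = ℕP.m≤n⇒m≤1+n (N≤M zero)
raiseAt≤raiseUpTo {suc _} (suc j) N≤M (suc k) = raiseAt≤raiseUpTo j (λ k → N≤M (suc k)) k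

raiseUpTo-inject₁ : ∀ {q} (j : Fin (suc q)) (c : Fin (suc q) → ℕ) (k : Fin q) → raiseUpTo j c (inject₁ k) ≡ raiseUpTo j (λ k → c (inject₁ k)) k
raiseUpTo-inject₁         zero    c zero    = ≡.refl
raiseUpTo-inject₁ {suc _} (suc j) c zero    = ≡.refl
raiseUpTo-inject₁         zero    c (suc k) = ≡.refl
raiseUpTo-inject₁ {suc _} (suc j) c (suc k) = raiseUpTo-inject₁ j (V.tail c) k

nu-raiseUpTo : ∀ {q} (j : Fin (suc q)) (c : Fin (suc q) → ℕ) → IsChain c → ∀ (k : Fin q) →
               nu (raiseUpTo j c) (inject₁ k) ≡ raiseAt j (λ k → nu c (inject₁ k)) k
nu-raiseUpTo         zero    c chain zero    = ℕP.+-∸-assoc 1 (chain zero)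
nu-raiseUpTo {suc _} (suc j) c chain zero    = ≡.cong (suc (c zero) ∸_) (raiseUpTo-zero j (V.tail c))
nu-raiseUpTo         zero    c chain (suc k) = ≡.refl
nu-raiseUpTo {suc _} (suc j) c chain (suc k) = nu-raiseUpTo j (V.tail c) (λ k → chain (suc k)) k

zeroChain : ∀ q → Fin (suc q) → ℕ
zeroChain zero    = λ _ → 0
zeroChain (suc q) = 0 V.∷ zeroChain q

zeroChain≗0 : ∀ q k → zeroChain q k ≡ 0
zeroChain≗0 zero    k       = ≡.refl
zeroChain≗0 (suc q) zero    = ≡.refl
zeroChain≗0 (suc q) (suc k) = zeroChain≗0 q k

chainsFrom-zero : ∀ q → chainsFrom q 0 ≡ zeroChain q ∷ []
chainsFrom-zero zero    = ≡.refl
chainsFrom-zero (suc q) = ≡.cong (λ cs → List.map (0 V.∷_) cs List.++ []) (chainsFrom-zero q)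

zeroTuple : ∀ q s → Fin s → Fin (suc q) → ℕ
zeroTuple q zero    = λ ()
zeroTuple q (suc s) = zeroChain q V.∷ zeroTuple q s

zeroTuple≗0 : ∀ q s i k → zeroTuple q s i k ≡ 0
zeroTuple≗0 q (suc s) zero    k = zeroChain≗0 q k
zeroTuple≗0 q (suc s) (suc i) k = zeroTuple≗0 q s i k

chainTuples-zeros : ∀ q s (ms : Fin s → ℕ) → ms ≗ (λ _ → 0) → chainTuples q s ms ≡ zeroTuple q s ∷ []
chainTuples-zeros q zero    ms ms≗0 = ≡.refl
chainTuples-zeros q (suc s) ms ms≗0 = ≡.trans
  (≡.cong₂ (λ m cs → concatMap (λ c → List.map (c V.∷_) cs) (chainsFrom q m)) (ms≗0 zero) (chainTuples-zeros q s (V.tail ms) (λ i → ms≗0 (suc i))))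
  (≡.cong (concatMap (λ c → List.map (c V.∷_) (zeroTuple q s ∷ []))) (chainsFrom-zero q))

tail-++ : ∀ {a} {A : Set a} {m n} (f : Fin (suc m) → A) (g : Fin n → A) → V.tail (f ++ g) ≗ V.tail f ++ g
tail-++ {m = m} f g i with splitAt m i
... | inj₁ _ = ≡.refl
... | inj₂ _ = ≡.refl

updateAt-suc-resp-≗ : ∀ {p} {u u' : Fin p → ℕ} → u ≗ u' → ∀ i → V.updateAt u i suc ≗ V.updateAt u' i suc
updateAt-suc-resp-≗ u≗u' zero    zero    = ≡.cong suc (u≗u' zero)
updateAt-suc-resp-≗ u≗u' zero    (suc l) = u≗u' (suc l)
updateAt-suc-resp-≗ u≗u' (suc i) zero    = u≗u' zero
updateAt-suc-resp-≗ u≗u' (suc i) (suc l) = updateAt-suc-resp-≗ (λ l → u≗u' (suc l)) i l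

updateAt-++ˡ : ∀ r {s} (n : Fin r → ℕ) (K : Fin s → ℕ) i → V.updateAt n i suc ++ K ≗ V.updateAt (n ++ K) (i ↑ˡ s) suc
updateAt-++ˡ (suc r) n K zero    zero    = ≡.refl
updateAt-++ˡ (suc r) n K (suc i) zero    = ≡.refl
updateAt-++ˡ (suc r) n K zero    (suc l) = ≡.trans (tail-++ (V.updateAt n zero suc) K l) (≡.sym (tail-++ n K l))
updateAt-++ˡ (suc r) {s} n K (suc i) (suc l) = ≡.trans (tail-++ (V.updateAt n (suc i) suc) K l)
  (≡.trans (updateAt-++ˡ r (V.tail n) K i l) (updateAt-suc-resp-≗ (λ l → ≡.sym (tail-++ n K l)) (i ↑ˡ s) l))

updateAt-++ʳ : ∀ r {s} (n : Fin r → ℕ) (K : Fin s → ℕ) i → n ++ V.updateAt K i suc ≗ V.updateAt (n ++ K) (r ↑ʳ i) suc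
updateAt-++ʳ zero    n K i l       = ≡.refl
updateAt-++ʳ (suc r) n K i zero    = ≡.refl
updateAt-++ʳ (suc r) n K i (suc l) = ≡.trans (tail-++ n (V.updateAt K i suc) l)
  (≡.trans (updateAt-++ʳ r (V.tail n) K i l) (updateAt-suc-resp-≗ (λ l → ≡.sym (tail-++ n K l)) (r ↑ʳ i) l))

pointMass : ∀ {r} → Fin r → ℕ → Fin r → ℕ
pointMass zero    c zero    = c
pointMass zero    c (suc l) = 0
pointMass (suc i) c zero    = 0
pointMass (suc i) c (suc l) = pointMass i c l

pointMass-zero : ∀ {r} (i l : Fin r) → pointMass i 0 l ≡ 0
pointMass-zero zero    zero    = ≡.refl
pointMass-zero zero    (suc l) = ≡.refl
pointMass-zero (suc i) zero    = ≡.refl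
pointMass-zero (suc i) (suc l) = pointMass-zero i l

pointMass-suc : ∀ {r} (i l : Fin r) c → pointMass i (suc c) l ≡ pointMass i c l ℕ.+ pointMass i 1 l
pointMass-suc zero    zero    c = ℕP.+-comm 1 c
pointMass-suc zero    (suc l) c = ≡.refl
pointMass-suc (suc i) zero    c = ≡.refl
pointMass-suc (suc i) (suc l) c = pointMass-suc i l c

updateAt-suc≡+pointMass : ∀ {r} (v : Fin r → ℕ) i l → V.updateAt v i suc l ≡ v l ℕ.+ pointMass i 1 l
updateAt-suc≡+pointMass v zero    zero    = ℕP.+-comm 1 (v zero)
updateAt-suc≡+pointMass v zero    (suc l) = ≡.sym (ℕP.+-identityʳ _)
updateAt-suc≡+pointMass v (suc i) zero    = ≡.sym (ℕP.+-identityʳ _)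
updateAt-suc≡+pointMass v (suc i) (suc l) = updateAt-suc≡+pointMass (V.tail v) i l

iter-updateAt-suc : ∀ {r} (i : Fin r) c K l → iter (λ K → V.updateAt K i suc) c K l ≡ K l ℕ.+ pointMass i c l
iter-updateAt-suc i zero K l = ≡.sym (≡.trans (≡.cong (K l ℕ.+_) (pointMass-zero i l)) (ℕP.+-identityʳ _))
iter-updateAt-suc {r} i (suc c) K l = begin
  V.updateAt Kc i suc l                                ≡⟨ updateAt-suc≡+pointMass Kc i l ⟩
  Kc l ℕ.+ pointMass i 1 l                             ≡⟨ ≡.cong (ℕ._+ pointMass i 1 l) (iter-updateAt-suc i c K l) ⟩
  (K l ℕ.+ pointMass i c l) ℕ.+ pointMass i 1 l        ≡⟨ ℕP.+-assoc (K l) _ _ ⟩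
  K l ℕ.+ (pointMass i c l ℕ.+ pointMass i 1 l)        ≡⟨ ≡.cong (K l ℕ.+_) (pointMass-suc i l c) ⟨
  K l ℕ.+ pointMass i (suc c) l                        ∎
  where
  open ≡.≡-Reasoning
  Kc : Fin r → ℕ
  Kc = iter (λ K → V.updateAt K i suc) c K

sum-pointMass : ∀ {r} (k : Fin r → ℕ) l → sumᴺ (λ l' → pointMass l' (k l') l) ≡ k l
sum-pointMass {suc r} k zero    = ≡.trans (≡.cong (k zero ℕ.+_) (sumᴺ-replicate-zero r)) (ℕP.+-identityʳ _)
sum-pointMass {suc r} k (suc l) = sum-pointMass (λ l' → k (suc l')) l

module NaturalEmbedding {c ℓ} (R : CommutativeRing c ℓ) where
  open CommutativeRing R hiding (zero)
  open import Relation.Binary.Reasoning.Setoid setoid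

  ι-+ : ∀ m n → ι R (m ℕ.+ n) ≈ ι R m + ι R n
  ι-+ zero    n = sym (+-identityˡ _)
  ι-+ (suc m) n = trans (+-congˡ (ι-+ m n)) (sym (+-assoc _ _ _))

  ι-* : ∀ m n → ι R (m ℕ.* n) ≈ ι R m * ι R n
  ι-* zero    n = sym (zeroˡ _)
  ι-* (suc m) n = begin
    ι R (n ℕ.+ m ℕ.* n)         ≈⟨ ι-+ n (m ℕ.* n) ⟩
    ι R n + ι R (m ℕ.* n)       ≈⟨ +-cong (sym (*-identityˡ _)) (ι-* m n) ⟩
    1# * ι R n + ι R m * ι R n  ≈⟨ distribʳ _ _ _ ⟨
    (1# + ι R m) * ι R n        ∎

module IntegerCoefficients {c ℓ} (R : CommutativeRing c ℓ) where
  open CommutativeRing R hiding (zero)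
  open import Algebra.Properties.Ring ring using (-‿involutive; -0#≈0#; -‿+-comm; -‿distribˡ-*; -‿distribʳ-*)
  open import Algebra.Properties.Semiring.Mult.TCOptimised semiring using (_×_; 1+×; ×-homo-+; ×1-homo-*)
  open import Relation.Binary.Reasoning.Setoid setoid

  ⟦_⟧ℤ : ℤ → Carrier
  ⟦ ℤ.+ n    ⟧ℤ = n × 1#
  ⟦ -[1+ n ] ⟧ℤ = - (suc n × 1#)

  private
    sgn : Sign → Carrier → Carrier
    sgn Sign.+ x = x
    sgn Sign.- x = - x

    sgn-cong : ∀ s {x y} → x ≈ y → sgn s x ≈ sgn s y
    sgn-cong Sign.- = -‿cong
    sgn-cong Sign.+ = λ x≈y → x≈y

    sgn-* : ∀ s t x y → sgn (s Sign.* t) (x * y) ≈ sgn s x * sgn t y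
    sgn-* Sign.- Sign.- x y = sym (trans (sym (-‿distribˡ-* x (- y))) (trans (-‿cong (sym (-‿distribʳ-* x y))) (-‿involutive (x * y))))
    sgn-* Sign.- Sign.+ x y = -‿distribˡ-* _ _
    sgn-* Sign.+ Sign.- x y = -‿distribʳ-* _ _
    sgn-* Sign.+ Sign.+ x y = refl

    ◃-homo : ∀ s n → ⟦ s ℤ.◃ n ⟧ℤ ≈ sgn s (n × 1#)
    ◃-homo Sign.- zero    = sym -0#≈0#
    ◃-homo Sign.+ zero    = refl
    ◃-homo Sign.- (suc n) = refl
    ◃-homo Sign.+ (suc n) = refl

    sign◃abs-homo : ∀ a → ⟦ a ⟧ℤ ≈ sgn (ℤ.sign a) (ℤ.∣ a ∣ × 1#)
    sign◃abs-homo (ℤ.+ zero)  = refl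
    sign◃abs-homo (ℤ.+ suc n) = refl
    sign◃abs-homo -[1+ n ]  = refl

    -‿homo : ∀ a → ⟦ ℤ.- a ⟧ℤ ≈ - ⟦ a ⟧ℤ
    -‿homo (ℤ.+ zero)  = sym -0#≈0#
    -‿homo (ℤ.+ suc n) = refl
    -‿homo -[1+ n ]  = sym (-‿involutive _)

    1+a-[1+b]≈a-b : ∀ a b → (1# + a) - (1# + b) ≈ a - b
    1+a-[1+b]≈a-b a b = begin
      (1# + a) - (1# + b)     ≈⟨ +-congˡ (-‿+-comm 1# b) ⟨
      (1# + a) + (- 1# - b)   ≈⟨ +-assoc _ _ _ ⟩
      1# + (a + (- 1# - b))   ≈⟨ +-congˡ (trans (sym (+-assoc _ _ _)) (trans (+-congʳ (+-comm _ _)) (+-assoc _ _ _))) ⟩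
      1# + (- 1# + (a - b))   ≈⟨ +-assoc _ _ _ ⟨
      (1# - 1#) + (a - b)     ≈⟨ +-congʳ (-‿inverseʳ 1#) ⟩
      0# + (a - b)            ≈⟨ +-identityˡ _ ⟩
      a - b                   ∎

    ⊖-homo : ∀ m n → ⟦ m ℤ.⊖ n ⟧ℤ ≈ m × 1# - n × 1#
    ⊖-homo zero n = begin
      ⟦ 0 ℤ.⊖ n ⟧ℤ    ≡⟨ ≡.cong ⟦_⟧ℤ (≡.trans (ℤP.⊖-swap 0 n) (≡.cong ℤ.-_ (ℤP.⊖-≥ ℕ.z≤n))) ⟩
      ⟦ ℤ.- (ℤ.+ n) ⟧ℤ  ≈⟨ -‿homo (ℤ.+ n) ⟩
      - (n × 1#)      ≈⟨ +-identityˡ _ ⟨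
      0# - n × 1#     ∎
    ⊖-homo (suc m) zero = begin
      ⟦ suc m ℤ.⊖ 0 ⟧ℤ       ≡⟨ ≡.cong ⟦_⟧ℤ (ℤP.⊖-≥ {suc m} ℕ.z≤n) ⟩
      suc m × 1#             ≈⟨ +-identityʳ _ ⟨
      suc m × 1# + 0#        ≈⟨ +-congˡ -0#≈0# ⟨
      suc m × 1# - 0#        ∎
    ⊖-homo (suc m) (suc n) = begin
      ⟦ suc m ℤ.⊖ suc n ⟧ℤ             ≡⟨ ≡.cong ⟦_⟧ℤ (ℤP.[1+m]⊖[1+n]≡m⊖n m n) ⟩
      ⟦ m ℤ.⊖ n ⟧ℤ                     ≈⟨ ⊖-homo m n ⟩
      m × 1# - n × 1#                  ≈⟨ 1+a-[1+b]≈a-b _ _ ⟨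
      (1# + m × 1#) - (1# + n × 1#)    ≈⟨ +-cong (1+× m 1#) (-‿cong (1+× n 1#)) ⟨
      suc m × 1# - suc n × 1#          ∎

    +-homo : ∀ a b → ⟦ a ℤ.+ b ⟧ℤ ≈ ⟦ a ⟧ℤ + ⟦ b ⟧ℤ
    +-homo -[1+ m ] -[1+ n ] = begin
      - (suc (suc (m ℕ.+ n)) × 1#)     ≡⟨ ≡.cong (λ k → - (suc k × 1#)) (ℕP.+-suc m n) ⟨
      - ((suc m ℕ.+ suc n) × 1#)       ≈⟨ -‿cong (×-homo-+ 1# (suc m) (suc n)) ⟩
      - (suc m × 1# + suc n × 1#)      ≈⟨ -‿+-comm _ _ ⟨
      - (suc m × 1#) + - (suc n × 1#)  ∎
    +-homo -[1+ m ] (ℤ.+ n)    = trans (⊖-homo n (suc m)) (+-comm _ _)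
    +-homo (ℤ.+ m)    -[1+ n ] = ⊖-homo m (suc n)
    +-homo (ℤ.+ m)    (ℤ.+ n)    = ×-homo-+ 1# m n

    *-homo : ∀ a b → ⟦ a ℤ.* b ⟧ℤ ≈ ⟦ a ⟧ℤ * ⟦ b ⟧ℤ
    *-homo a b = begin
      ⟦ s ℤ.◃ (∣a∣ ℕ.* ∣b∣) ⟧ℤ                                ≈⟨ ◃-homo s (∣a∣ ℕ.* ∣b∣) ⟩
      sgn s ((∣a∣ ℕ.* ∣b∣) × 1#)                              ≈⟨ sgn-cong s (×1-homo-* ∣a∣ ∣b∣) ⟩
      sgn s (∣a∣ × 1# * ∣b∣ × 1#)                             ≈⟨ sgn-* (ℤ.sign a) (ℤ.sign b) _ _ ⟩
      sgn (ℤ.sign a) (∣a∣ × 1#) * sgn (ℤ.sign b) (∣b∣ × 1#)   ≈⟨ *-cong (sign◃abs-homo a) (sign◃abs-homo b) ⟨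
      ⟦ a ⟧ℤ * ⟦ b ⟧ℤ                                         ∎
      where
      s : Sign
      s = ℤ.sign a Sign.* ℤ.sign b
      ∣a∣ ∣b∣ : ℕ
      ∣a∣ = ℤ.∣ a ∣
      ∣b∣ = ℤ.∣ b ∣

  ℤ-homomorphism : ℤ.+-*-rawRing -Raw-AlmostCommutative⟶ fromCommutativeRing R
  ℤ-homomorphism = record
    { ⟦_⟧ = ⟦_⟧ℤ ; +-homo = +-homo ; *-homo = *-homo ; -‿homo = -‿homo
    ; 0-homo = refl ; 1-homo = refl }

  ⟦⟧ℤ-≟ : ∀ a b → Maybe (⟦ a ⟧ℤ ≈ ⟦ b ⟧ℤ)
  ⟦⟧ℤ-≟ a b with a ℤP.≟ b
  ... | yes a≡b = just (reflexive (≡.cong ⟦_⟧ℤ a≡b))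
  ... | no _    = nothing

  open RingSolver ℤ.+-*-rawRing (fromCommutativeRing R) ℤ-homomorphism ⟦⟧ℤ-≟ public

module _ {c ℓ} (F : CharZeroField c ℓ) where
  open CharZeroField F
  open FieldDefs F
  open NaturalEmbedding commutativeRing
  open IntegerCoefficients commutativeRing
  open import Algebra.Properties.Semiring.Sum semiring using (sum; sum-cong-≋; sum-cong-≗; *-distribˡ-sum; ∑-distrib-+; ∑-comm; sum-init-last)
  open import Relation.Binary.Reasoning.Setoid setoid

  :0 :1 : ∀ {n} → Polynomial n
  :0 = con (ℤ.+ 0)
  :1 = con (ℤ.+ 1)

  _≉0 : Carrier → Set ℓ
  x ≉0 = ¬ (x ≈ 0#)

  1≉0 : 1# ≉0
  1≉0 1≈0 = charZero 0 (trans (+-identityʳ 1#) 1≈0)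

  *-≉0 : ∀ {x y} → x ≉0 → y ≉0 → (x * y) ≉0
  *-≉0 {x} {y} x≉0 y≉0 xy≈0 = y≉0 (begin
    y                  ≈⟨ *-identityˡ y ⟨
    1# * y             ≈⟨ *-congʳ (trans (*-comm _ _) (⁻¹-inverse x x≉0)) ⟨
    (x ⁻¹ * x) * y     ≈⟨ *-assoc _ _ _ ⟩
    x ⁻¹ * (x * y)     ≈⟨ *-congˡ xy≈0 ⟩
    x ⁻¹ * 0#          ≈⟨ zeroʳ _ ⟩
    0#                 ∎)

  ⁻¹-≉0 : ∀ {x} → x ≉0 → (x ⁻¹) ≉0
  ⁻¹-≉0 {x} x≉0 x⁻¹≈0 = 1≉0 (begin
    1#          ≈⟨ ⁻¹-inverse x x≉0 ⟨
    x * x ⁻¹    ≈⟨ *-congˡ x⁻¹≈0 ⟩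
    x * 0#      ≈⟨ zeroʳ _ ⟩
    0#          ∎)

  ≉0-resp-≈ : ∀ {x y} → x ≈ y → x ≉0 → y ≉0
  ≉0-resp-≈ x≈y x≉0 y≈0 = x≉0 (trans x≈y y≈0)

  ⁻¹-unique : ∀ {x y} → x ≉0 → x * y ≈ 1# → y ≈ x ⁻¹
  ⁻¹-unique {x} {y} x≉0 xy≈1 = begin
    y                ≈⟨ *-identityʳ y ⟨
    y * 1#           ≈⟨ *-congˡ (⁻¹-inverse x x≉0) ⟨
    y * (x * x ⁻¹)   ≈⟨ *-assoc _ _ _ ⟨
    (y * x) * x ⁻¹   ≈⟨ *-congʳ (trans (*-comm y x) xy≈1) ⟩
    1# * x ⁻¹        ≈⟨ *-identityˡ _ ⟩
    x ⁻¹             ∎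

  ⁻¹-cong : ∀ {x y} → x ≉0 → x ≈ y → x ⁻¹ ≈ y ⁻¹
  ⁻¹-cong {x} x≉0 x≈y = ⁻¹-unique (≉0-resp-≈ x≈y x≉0) (trans (*-congʳ (sym x≈y)) (⁻¹-inverse x x≉0))

  ⁻¹-distrib-* : ∀ {x y} → x ≉0 → y ≉0 → (x * y) ⁻¹ ≈ x ⁻¹ * y ⁻¹
  ⁻¹-distrib-* {x} {y} x≉0 y≉0 = sym (⁻¹-unique (*-≉0 x≉0 y≉0) (begin
    (x * y) * (x ⁻¹ * y ⁻¹)    ≈⟨ solve 4 (λ x y x⁻¹ y⁻¹ → (x :* y) :* (x⁻¹ :* y⁻¹) := (x :* x⁻¹) :* (y :* y⁻¹)) refl x y (x ⁻¹) (y ⁻¹) ⟩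
    (x * x ⁻¹) * (y * y ⁻¹)    ≈⟨ *-cong (⁻¹-inverse x x≉0) (⁻¹-inverse y y≉0) ⟩
    1# * 1#                    ≈⟨ *-identityˡ _ ⟩
    1#                         ∎))

  ⁻¹-+-⁻¹ : ∀ {X Y Z} → X ≉0 → Y ≉0 → Z ≉0 → X * Y ≈ Z * (X + Y) → X ⁻¹ + Y ⁻¹ ≈ Z ⁻¹
  ⁻¹-+-⁻¹ {X} {Y} {Z} X≉0 Y≉0 Z≉0 XY≈Z[X+Y] = sym (begin
    Z ⁻¹                                            ≈⟨ solve 1 (λ z → z := z :* (:1 :* :1)) refl (Z ⁻¹) ⟩
    Z ⁻¹ * (1# * 1#)                                ≈⟨ *-congˡ (*-cong (⁻¹-inverse X X≉0) (⁻¹-inverse Y Y≉0)) ⟨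
    Z ⁻¹ * ((X * X ⁻¹) * (Y * Y ⁻¹))                ≈⟨ solve 5 (λ z⁻¹ X x⁻¹ Y y⁻¹ → z⁻¹ :* ((X :* x⁻¹) :* (Y :* y⁻¹)) := (z⁻¹ :* (X :* Y)) :* (x⁻¹ :* y⁻¹)) refl (Z ⁻¹) X (X ⁻¹) Y (Y ⁻¹) ⟩
    (Z ⁻¹ * (X * Y)) * (X ⁻¹ * Y ⁻¹)                ≈⟨ *-congʳ (*-congˡ XY≈Z[X+Y]) ⟩
    (Z ⁻¹ * (Z * (X + Y))) * (X ⁻¹ * Y ⁻¹)          ≈⟨ solve 6 (λ z⁻¹ Z X x⁻¹ Y y⁻¹ → (z⁻¹ :* (Z :* (X :+ Y))) :* (x⁻¹ :* y⁻¹) := (Z :* z⁻¹) :* ((X :* x⁻¹) :* y⁻¹ :+ (Y :* y⁻¹) :* x⁻¹)) refl (Z ⁻¹) Z X (X ⁻¹) Y (Y ⁻¹) ⟩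
    (Z * Z ⁻¹) * ((X * X ⁻¹) * Y ⁻¹ + (Y * Y ⁻¹) * X ⁻¹) ≈⟨ *-cong (⁻¹-inverse Z Z≉0) (+-cong (*-congʳ (⁻¹-inverse X X≉0)) (*-congʳ (⁻¹-inverse Y Y≉0))) ⟩
    1# * (1# * Y ⁻¹ + 1# * X ⁻¹)                    ≈⟨ solve 2 (λ a b → :1 :* (:1 :* b :+ :1 :* a) := a :+ b) refl (X ⁻¹) (Y ⁻¹) ⟩
    X ⁻¹ + Y ⁻¹                                     ∎)

  ιF-!≉0 : ∀ n → ιF (n !) ≉0
  ιF-!≉0 n with n ! | ℕP.1≤n! n
  ... | suc k | _ = charZero k

  falling-cong : ∀ {z z'} n → z ≈ z' → falling z n ≈ falling z' n
  falling-cong zero    z≈z' = refl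
  falling-cong (suc n) z≈z' = *-cong (falling-cong n z≈z') (+-congʳ z≈z')

  falling-suc : ∀ z n → falling (z + 1#) (suc n) ≈ (z + 1#) * falling z n
  falling-suc z zero = solve 1 (λ z → :1 :* ((z :+ :1) :- :0) := (z :+ :1) :* :1) refl z
  falling-suc z (suc n) = begin
    falling (z + 1#) (suc n) * ((z + 1#) - ιF (suc n))         ≈⟨ *-congʳ (falling-suc z n) ⟩
    ((z + 1#) * falling z n) * ((z + 1#) - (1# + ιF n))        ≈⟨ solve 3 (λ z f i → ((z :+ :1) :* f) :* ((z :+ :1) :- (:1 :+ i)) := (z :+ :1) :* (f :* (z :- i))) refl z (falling z n) (ιF n) ⟩
    (z + 1#) * (falling z n * (z - ιF n))                      ∎

  den : Carrier → ℕ → ℕ → Carrier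
  den t M N = binom (ιF M + t - 1#) N * (ιF M + t)

  -- With a = M + t, f = (a-1)⋯(a-N) and g = a⋯(a-N+1): the three factors are a f (a+1)/(N+1)!,
  -- g (a+1)/N! and a f/N!, and a f = g (a - N).
  den-pascal-cleared : ∀ t M N →
    den t (suc M) (suc N) * den t (suc M) N ≈ den t M N * (den t (suc M) (suc N) + den t (suc M) N)
  den-pascal-cleared t M N = begin
    X * Y                                                     ≈⟨ *-cong X≈ Y≈ ⟩
    (((a * f) * (v * u)) * (a + 1#)) * ((g * u) * (a + 1#))
      ≈⟨ solve 6 (λ f u a v g n → (((a :* f) :* (v :* u)) :* (a :+ :1)) :* ((g :* u) :* (a :+ :1)) := (f :* u :* a :* u :* (a :+ :1)) :* ((g :* (a :- n)) :* v :+ g :* ((:1 :+ n) :* v))) refl f u a v g n ⟩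
    (f * u * a * u * (a + 1#)) * ((g * (a - n)) * v + g * (ιF (suc N) * v))
      ≈⟨ *-congˡ (+-cong (*-congʳ (sym af≈g[a-n])) (trans (*-congˡ (⁻¹-inverse (ιF (suc N)) (charZero N))) (*-identityʳ g))) ⟩
    (f * u * a * u * (a + 1#)) * ((a * f) * v + g)
      ≈⟨ solve 5 (λ f u a v g → (f :* u :* a :* u :* (a :+ :1)) :* ((a :* f) :* v :+ g) := ((f :* u) :* a) :* (((a :* f) :* (v :* u)) :* (a :+ :1) :+ (g :* u) :* (a :+ :1))) refl f u a v g ⟩
    den t M N * (((a * f) * (v * u)) * (a + 1#) + (g * u) * (a + 1#)) ≈⟨ *-congˡ (+-cong X≈ Y≈) ⟨
    den t M N * (X + Y)                                       ∎
    where
    a f g n u v : Carrier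
    a = ιF M + t
    f = falling (a - 1#) N
    g = falling a N
    n = ιF N
    u = ιF (N !) ⁻¹
    v = ιF (suc N) ⁻¹
    X Y : Carrier
    X = den t (suc M) (suc N)
    Y = den t (suc M) N
    a+1 : ιF (suc M) + t ≈ a + 1#
    a+1 = solve 2 (λ m t → (:1 :+ m) :+ t := (m :+ t) :+ :1) refl (ιF M) t
    a+1-1≈a : ιF (suc M) + t - 1# ≈ a
    a+1-1≈a = solve 2 (λ m t → ((:1 :+ m) :+ t) :- :1 := m :+ t) refl (ιF M) t
    falling[a,N+1] : falling (ιF (suc M) + t - 1#) (suc N) ≈ a * f
    falling[a,N+1] = begin
      falling (ιF (suc M) + t - 1#) (suc N) ≈⟨ falling-cong (suc N) (solve 2 (λ m t → ((:1 :+ m) :+ t) :- :1 := ((m :+ t) :- :1) :+ :1) refl (ιF M) t) ⟩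
      falling ((a - 1#) + 1#) (suc N)       ≈⟨ falling-suc (a - 1#) N ⟩
      ((a - 1#) + 1#) * f                   ≈⟨ *-congʳ (solve 1 (λ a → (a :- :1) :+ :1 := a) refl a) ⟩
      a * f                                 ∎
    af≈g[a-n] : a * f ≈ g * (a - n)
    af≈g[a-n] = begin
      a * f                                                         ≈⟨ falling[a,N+1] ⟨
      falling (ιF (suc M) + t - 1#) N * (ιF (suc M) + t - 1# - n)   ≈⟨ *-cong (falling-cong N a+1-1≈a) (+-congʳ a+1-1≈a) ⟩
      g * (a - n)                                                   ∎
    X≈ : X ≈ ((a * f) * (v * u)) * (a + 1#)
    X≈ = *-cong (*-cong falling[a,N+1] (trans (⁻¹-cong (ιF-!≉0 (suc N)) (ι-* (suc N) (N !))) (⁻¹-distrib-* (charZero N) (ιF-!≉0 N)))) a+1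
    Y≈ : Y ≈ (g * u) * (a + 1#)
    Y≈ = *-cong (*-congʳ (falling-cong N a+1-1≈a)) a+1

  module _ (t : Carrier) (t≉-m : ∀ m → ¬ (t ≈ - ιF m)) where

    ιF+t≉0 : ∀ m → (ιF m + t) ≉0
    ιF+t≉0 m m+t≈0 = t≉-m m (begin
      t                  ≈⟨ solve 2 (λ t i → t := (i :+ t) :- i) refl t (ιF m) ⟩
      (ιF m + t) - ιF m  ≈⟨ +-congʳ m+t≈0 ⟩
      0# - ιF m          ≈⟨ +-identityˡ _ ⟩
      - ιF m             ∎)

    falling≉0 : ∀ M N → N ≤ M → falling (ιF M + t - 1#) N ≉0
    falling≉0 M zero    _    = 1≉0
    falling≉0 M (suc N) N<M = *-≉0 (falling≉0 M N (ℕP.<⇒≤ N<M)) (≉0-resp-≈ (sym factor≈) (ιF+t≉0 (M ∸ suc N)))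
      where
      factor≈ : (ιF M + t - 1#) - ιF N ≈ ιF (M ∸ suc N) + t
      factor≈ = begin
        (ιF M + t - 1#) - ιF N                              ≈⟨ +-congʳ (+-congʳ (+-congʳ (trans (reflexive (≡.cong ιF (≡.sym (ℕP.m+[n∸m]≡n N<M)))) (ι-+ (suc N) _)))) ⟩
        (((1# + ιF N) + ιF (M ∸ suc N)) + t - 1#) - ιF N    ≈⟨ solve 3 (λ i r t → (((:1 :+ i) :+ r) :+ t :- :1) :- i := r :+ t) refl (ιF N) (ιF (M ∸ suc N)) t ⟩
        ιF (M ∸ suc N) + t                                  ∎

    den≉0 : ∀ M N → N ≤ M → den t M N ≉0
    den≉0 M N N≤M = *-≉0 (*-≉0 (falling≉0 M N N≤M) (⁻¹-≉0 (ιF-!≉0 N))) (ιF+t≉0 M)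

    den⁻¹-pascal : ∀ M N → N ≤ M → den t (suc M) (suc N) ⁻¹ + den t (suc M) N ⁻¹ ≈ den t M N ⁻¹
    den⁻¹-pascal M N N≤M =
      ⁻¹-+-⁻¹ (den≉0 (suc M) (suc N) (s≤s N≤M)) (den≉0 (suc M) N (ℕP.m≤n⇒m≤1+n N≤M)) (den≉0 M N N≤M) (den-pascal-cleared t M N)

  sumOver : ∀ {A : Set} → List A → (A → Carrier) → Carrier
  sumOver xs f = sumL (List.map f xs)

  syntax sumOver xs (λ x → e) = ∑[ x ∈ xs ] e

  sumOver-cong : ∀ {A : Set} (xs : List A) {f g : A → Carrier} → (∀ x → f x ≈ g x) → sumOver xs f ≈ sumOver xs g
  sumOver-cong []       f≈g = refl
  sumOver-cong (x ∷ xs) f≈g = +-cong (f≈g x) (sumOver-cong xs f≈g)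

  sumOver-congᴬ : ∀ {A : Set} {xs : List A} {f g : A → Carrier} → All (λ x → f x ≈ g x) xs → sumOver xs f ≈ sumOver xs g
  sumOver-congᴬ []           = refl
  sumOver-congᴬ (fx≈gx ∷ ps) = +-cong fx≈gx (sumOver-congᴬ ps)

  sumOver-++ : ∀ {A : Set} (xs ys : List A) f → sumOver (xs List.++ ys) f ≈ sumOver xs f + sumOver ys f
  sumOver-++ []       ys f = sym (+-identityˡ _)
  sumOver-++ (x ∷ xs) ys f = trans (+-congˡ (sumOver-++ xs ys f)) (sym (+-assoc _ _ _))

  sumOver-map : ∀ {A B : Set} (xs : List A) (h : A → B) f → sumOver (List.map h xs) f ≡ sumOver xs (λ x → f (h x))
  sumOver-map []       h f = ≡.refl
  sumOver-map (x ∷ xs) h f = ≡.cong (f (h x) +_) (sumOver-map xs h f)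

  sumOver-concatMap : ∀ {A B : Set} (xs : List A) (G : A → List B) f → sumOver (concatMap G xs) f ≈ ∑[ x ∈ xs ] sumOver (G x) f
  sumOver-concatMap []       G f = refl
  sumOver-concatMap (x ∷ xs) G f = trans (sumOver-++ (G x) (concatMap G xs) f) (+-congˡ (sumOver-concatMap xs G f))

  *-distribˡ-sumOver : ∀ {A : Set} (xs : List A) a f → a * sumOver xs f ≈ ∑[ x ∈ xs ] (a * f x)
  *-distribˡ-sumOver []       a f = zeroʳ a
  *-distribˡ-sumOver (x ∷ xs) a f = trans (distribˡ _ _ _) (+-congˡ (*-distribˡ-sumOver xs a f))

  sumOver-distrib-+ : ∀ {A : Set} (xs : List A) f g → ∑[ x ∈ xs ] (f x + g x) ≈ sumOver xs f + sumOver xs g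
  sumOver-distrib-+ []       f g = sym (+-identityʳ 0#)
  sumOver-distrib-+ (x ∷ xs) f g = trans (+-congˡ (sumOver-distrib-+ xs f g))
    (solve 4 (λ a b c d → (a :+ b) :+ (c :+ d) := (a :+ c) :+ (b :+ d)) refl (f x) (g x) _ _)

  sum-sumOver-comm : ∀ {n} {A : Set} (xs : List A) (f : Fin n → A → Carrier) → sum (λ j → sumOver xs (f j)) ≈ ∑[ x ∈ xs ] sum (λ j → f j x)
  sum-sumOver-comm {zero}  xs f = sym (zeros xs)
    where
    zeros : ∀ xs → sumOver xs (λ _ → 0#) ≈ 0#
    zeros []       = refl
    zeros (x ∷ xs) = trans (+-identityˡ _) (zeros xs)
  sum-sumOver-comm {suc n} xs f = trans (+-congˡ (sum-sumOver-comm xs (λ j → f (suc j)))) (sym (sumOver-distrib-+ xs (f zero) _))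

  sumN : ℕ → (ℕ → Carrier) → Carrier
  sumN n f = sum (λ (k : Fin n) → f (toℕ k))

  sumOver-applyUpTo : ∀ n (g : ℕ → ℕ) f → sumOver (applyUpTo g n) f ≡ sumN n (λ k → f (g k))
  sumOver-applyUpTo zero    g f = ≡.refl
  sumOver-applyUpTo (suc n) g f = ≡.cong (f (g zero) +_) (sumOver-applyUpTo n (λ k → g (suc k)) f)

  sumN-cong< : ∀ n {f g : ℕ → Carrier} → (∀ k → k < n → f k ≈ g k) → sumN n f ≈ sumN n g
  sumN-cong< n f≈g = sum-cong-≋ (λ k → f≈g (toℕ k) (FinP.toℕ<n k))

  sumN-distrib-+ : ∀ n (f g : ℕ → Carrier) → sumN n (λ k → f k + g k) ≈ sumN n f + sumN n g
  sumN-distrib-+ n f g = ∑-distrib-+ {n} (λ k → f (toℕ k)) (λ k → g (toℕ k))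

  *-distribˡ-sumN : ∀ n a (f : ℕ → Carrier) → a * sumN n f ≈ sumN n (λ k → a * f k)
  *-distribˡ-sumN n a f = *-distribˡ-sum {n} a (λ k → f (toℕ k))

  sum-sumN-comm : ∀ {p} n (f : Fin p → ℕ → Carrier) → sum (λ j → sumN n (f j)) ≈ sumN n (λ k → sum (λ j → f j k))
  sum-sumN-comm {p} n f = ∑-comm {p} {n} (λ j k → f j (toℕ k))

  sumN-suc : ∀ n (f : ℕ → Carrier) → sumN (suc n) f ≈ sumN n f + f n
  sumN-suc n f = begin
    sumN (suc n) f                                         ≈⟨ sum-init-last {n} (λ k → f (toℕ k)) ⟩
    sum {n} (λ k → f (toℕ (inject₁ k))) + f (toℕ (Fin.fromℕ n)) ≡⟨ ≡.cong₂ _+_ (sum-cong-≗ {n} (λ k → ≡.cong f (FinP.toℕ-inject₁ k))) (≡.cong f (FinP.toℕ-fromℕ n)) ⟩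
    sumN n f + f n                                         ∎

  binomialTransform-suc : ∀ m x (T : ℕ → Carrier) →
    sumN (suc (suc m)) (λ k → (ιF (suc m C k) * pow x (suc m ∸ k)) * T k) ≈
    x * sumN (suc m) (λ k → (ιF (m C k) * pow x (m ∸ k)) * T k) + sumN (suc m) (λ k → (ιF (m C k) * pow x (m ∸ k)) * T (suc k))
  binomialTransform-suc m x T = begin
    T₀ + sumN (suc m) (λ k → (ιF (suc m C suc k) * pow x (m ∸ k)) * T (suc k))
      ≈⟨ +-congˡ (sumN-cong< (suc m) (λ k _ → pascal k)) ⟩
    T₀ + sumN (suc m) (λ k → A k + B k)                ≈⟨ +-congˡ (sumN-distrib-+ (suc m) A B) ⟩
    T₀ + (sumN (suc m) A + sumN (suc m) B)             ≈⟨ +-congˡ (+-congʳ (sumN-suc m A)) ⟩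
    T₀ + ((sumN m A + A m) + sumN (suc m) B)           ≈⟨ +-congˡ (+-congʳ (+-congˡ Am≈0)) ⟩
    T₀ + ((sumN m A + 0#) + sumN (suc m) B)            ≈⟨ +-congˡ (+-congʳ (trans (+-identityʳ _) (sumN-cong< m A≈xA'))) ⟩
    T₀ + (sumN m (λ k → x * A' k) + sumN (suc m) B)    ≈⟨ +-congˡ (+-congʳ (*-distribˡ-sumN m x A')) ⟨
    T₀ + (x * sumN m A' + sumN (suc m) B)
      ≈⟨ solve 6 (λ i x p t s b → (i :* (x :* p)) :* t :+ (x :* s :+ b) := x :* ((i :* p) :* t :+ s) :+ b) refl (ιF 1) x (pow x m) (T 0) (sumN m A') (sumN (suc m) B) ⟩
    x * ((ιF 1 * pow x m) * T 0 + sumN m A') + sumN (suc m) B ∎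
    where
    T₀ : Carrier
    T₀ = (ιF 1 * pow x (suc m)) * T 0
    A A' B : ℕ → Carrier
    A k = (ιF (m C suc k) * pow x (m ∸ k)) * T (suc k)
    A' k = (ιF (m C suc k) * pow x (m ∸ suc k)) * T (suc k)
    B k = (ιF (m C k) * pow x (m ∸ k)) * T (suc k)
    pascal : ∀ k → (ιF (suc m C suc k) * pow x (m ∸ k)) * T (suc k) ≈ A k + B k
    pascal k = begin
      (ιF (suc m C suc k) * pow x (m ∸ k)) * T (suc k)          ≡⟨ ≡.cong (λ n → (ιF n * pow x (m ∸ k)) * T (suc k)) (nCk+nC[k+1]≡[n+1]C[k+1] m k) ⟨
      (ιF (m C k ℕ.+ m C suc k) * pow x (m ∸ k)) * T (suc k)    ≈⟨ *-congʳ (*-congʳ (ι-+ (m C k) (m C suc k))) ⟩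
      ((ιF (m C k) + ιF (m C suc k)) * pow x (m ∸ k)) * T (suc k)
        ≈⟨ solve 4 (λ a b p t → ((a :+ b) :* p) :* t := (b :* p) :* t :+ (a :* p) :* t) refl (ιF (m C k)) (ιF (m C suc k)) (pow x (m ∸ k)) (T (suc k)) ⟩
      A k + B k                                                 ∎
    Am≈0 : A m ≈ 0#
    Am≈0 = begin
      (ιF (m C suc m) * pow x (m ∸ m)) * T (suc m) ≡⟨ ≡.cong (λ n → (ιF n * pow x (m ∸ m)) * T (suc m)) (k>n⇒nCk≡0 (ℕP.n<1+n m)) ⟩
      (0# * pow x (m ∸ m)) * T (suc m)             ≈⟨ trans (*-congʳ (zeroˡ _)) (zeroˡ _) ⟩
      0#                                           ∎
    A≈xA' : ∀ k → k < m → A k ≈ x * A' k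
    A≈xA' k k<m = begin
      (ιF (m C suc k) * pow x (m ∸ k)) * T (suc k)              ≡⟨ ≡.cong (λ n → (ιF (m C suc k) * pow x n) * T (suc k)) (ℕP.+-∸-assoc 1 k<m) ⟩
      (ιF (m C suc k) * (x * pow x (m ∸ suc k))) * T (suc k)    ≈⟨ solve 4 (λ a x p t → (a :* (x :* p)) :* t := x :* ((a :* p) :* t)) refl (ιF (m C suc k)) x (pow x (m ∸ suc k)) (T (suc k)) ⟩
      x * A' k                                                  ∎

  AvoidsNonPositiveIntegers : ∀ {q} → (Fin q → Carrier) → Set ℓ
  AvoidsNonPositiveIntegers t = ∀ j m → ¬ (t j ≈ - ιF m)

  Den : ∀ {q} → (Fin q → Carrier) → (Fin q → ℕ) → (Fin q → ℕ) → Carrier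
  Den t M N = prodF (λ j → den (t j) (M j) (N j))

  Den≉0 : ∀ {q} (t : Fin q → Carrier) → AvoidsNonPositiveIntegers t → ∀ {M N} → Pointwise _≤_ N M → Den t M N ≉0
  Den≉0 {zero}  t t-free N≤M = 1≉0
  Den≉0 {suc q} t t-free N≤M =
    *-≉0 (den≉0 (t zero) (t-free zero) _ _ (N≤M zero)) (Den≉0 (λ j → t (suc j)) (λ j → t-free (suc j)) (λ k → N≤M (suc k)))

  Den⁻¹-split : ∀ {q} (t : Fin q → Carrier) → AvoidsNonPositiveIntegers t → ∀ M N → Pointwise _≤_ N M →
                sum (λ (j : Fin (suc q)) → Den t (raiseUpTo j M) (raiseAt j N) ⁻¹) ≈ Den t M N ⁻¹
  Den⁻¹-split {zero}  t t-free M N N≤M = +-identityʳ _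
  Den⁻¹-split {suc q} t t-free M N N≤M = begin
    (A * D) ⁻¹ + sum {suc q} (λ j → (B * D' j) ⁻¹)   ≈⟨ +-cong (⁻¹-distrib-* A≉0 D≉0) (sum-cong-≋ (λ j → ⁻¹-distrib-* B≉0 (D'≉0 j))) ⟩
    A ⁻¹ * D ⁻¹ + sum {suc q} (λ j → B ⁻¹ * D' j ⁻¹) ≈⟨ +-congˡ (*-distribˡ-sum (B ⁻¹) (λ j → D' j ⁻¹)) ⟨
    A ⁻¹ * D ⁻¹ + B ⁻¹ * sum {suc q} (λ j → D' j ⁻¹) ≈⟨ +-congˡ (*-congˡ (Den⁻¹-split t' t'-free M' N' N'≤M')) ⟩
    A ⁻¹ * D ⁻¹ + B ⁻¹ * D ⁻¹                        ≈⟨ distribʳ _ _ _ ⟨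
    (A ⁻¹ + B ⁻¹) * D ⁻¹                             ≈⟨ *-congʳ (den⁻¹-pascal (t zero) (t-free zero) (M zero) (N zero) (N≤M zero)) ⟩
    C ⁻¹ * D ⁻¹                                      ≈⟨ ⁻¹-distrib-* C≉0 D≉0 ⟨
    (C * D) ⁻¹                                       ∎
    where
    t' : Fin q → Carrier
    t' j = t (suc j)
    t'-free : AvoidsNonPositiveIntegers t'
    t'-free j = t-free (suc j)
    M' N' : Fin q → ℕ
    M' = V.tail M
    N' = V.tail N
    N'≤M' : Pointwise _≤_ N' M'
    N'≤M' k = N≤M (suc k)
    A B C D : Carrier
    A = den (t zero) (suc (M zero)) (suc (N zero))
    B = den (t zero) (suc (M zero)) (N zero)
    C = den (t zero) (M zero) (N zero)
    D = Den t' M' N'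
    D' : Fin (suc q) → Carrier
    D' j = Den t' (raiseUpTo j M') (raiseAt j N')
    A≉0 : A ≉0
    A≉0 = den≉0 (t zero) (t-free zero) _ _ (s≤s (N≤M zero))
    B≉0 : B ≉0
    B≉0 = den≉0 (t zero) (t-free zero) _ _ (ℕP.m≤n⇒m≤1+n (N≤M zero))
    C≉0 : C ≉0
    C≉0 = den≉0 (t zero) (t-free zero) _ _ (N≤M zero)
    D≉0 : D ≉0
    D≉0 = Den≉0 t' t'-free N'≤M'
    D'≉0 : ∀ j → D' j ≉0
    D'≉0 j = Den≉0 t' t'-free (raiseAt≤raiseUpTo j N'≤M')

  chainWeight : ∀ {q} → (Fin (suc q) → Carrier) → (Fin (suc q) → ℕ) → Carrier
  chainWeight y c = ιF (multinomial (c zero) (nu c)) * prodF (λ j → pow (y j) (nu c j))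

  chainWeight-single : ∀ (y : Fin 1 → Carrier) n → chainWeight y (λ _ → n) ≈ pow (y zero) n
  chainWeight-single y n = trans (*-congʳ (reflexive (≡.cong ιF (multinomial≡1 n (nu {zero} (λ _ → n)) (ℕP.*-identityʳ (n !))))))
    (solve 1 (λ p → (:1 :+ :0) :* (p :* :1) := p) refl (pow (y zero) n))

  chainWeight-∷ : ∀ {q} (y : Fin (suc (suc q)) → Carrier) n (c : Fin (suc q) → ℕ) → c zero ≤ n → MultinomialExact c →
    chainWeight y (n V.∷ c) ≈ (ιF (n C c zero) * pow (y zero) (n ∸ c zero)) * chainWeight (V.tail y) c
  chainWeight-∷ y n c c₀≤n exact = begin
    ιF (multinomial n (nu (n V.∷ c))) * (pow (y zero) (n ∸ c zero) * P)
      ≈⟨ *-congʳ (trans (reflexive (≡.cong ιF (multinomial-∷ n c c₀≤n exact))) (ι-* (n C c zero) μ)) ⟩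
    (ιF (n C c zero) * ιF μ) * (pow (y zero) (n ∸ c zero) * P)
      ≈⟨ solve 4 (λ a b p q → (a :* b) :* (p :* q) := (a :* p) :* (b :* q)) refl (ιF (n C c zero)) (ιF μ) (pow (y zero) (n ∸ c zero)) P ⟩
    (ιF (n C c zero) * pow (y zero) (n ∸ c zero)) * (ιF μ * P) ∎
    where
    P : Carrier
    P = prodF (λ j → pow (y (suc j)) (nu c j))
    μ : ℕ
    μ = multinomial (c zero) (nu c)

  sumOver-chainsFrom-suc : ∀ q n (f : (Fin (suc (suc q)) → ℕ) → Carrier) →
    sumOver (chainsFrom (suc q) n) f ≈ sumN (suc n) (λ m → ∑[ c ∈ chainsFrom q m ] f (n V.∷ c))
  sumOver-chainsFrom-suc q n f = begin
    sumOver (chainsFrom (suc q) n) f                                           ≈⟨ sumOver-concatMap (upTo (suc n)) (λ m → List.map (n V.∷_) (chainsFrom q m)) f ⟩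
    ∑[ m ∈ upTo (suc n) ] sumOver (List.map (n V.∷_) (chainsFrom q m)) f       ≡⟨ sumOver-applyUpTo (suc n) (λ k → k) _ ⟩
    sumN (suc n) (λ m → sumOver (List.map (n V.∷_) (chainsFrom q m)) f)        ≡⟨ sum-cong-≗ {suc n} (λ m → sumOver-map (chainsFrom q (toℕ m)) (n V.∷_) f) ⟩
    sumN (suc n) (λ m → ∑[ c ∈ chainsFrom q m ] f (n V.∷ c))                  ∎

  sumOver-chainsFrom-∷ : ∀ {q} (y : Fin (suc (suc q)) → Carrier) n m → m ≤ n → (ψ : (Fin (suc q) → ℕ) → Carrier) →
    ∑[ c ∈ chainsFrom q m ] (chainWeight y (n V.∷ c) * ψ c) ≈
    (ιF (n C m) * pow (y zero) (n ∸ m)) * ∑[ c ∈ chainsFrom q m ] (chainWeight (V.tail y) c * ψ c)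
  sumOver-chainsFrom-∷ {q} y n m m≤n ψ =
    trans (sumOver-congᴬ (All.map (peel m≤n) (chainsFrom-chains q m))) (sym (*-distribˡ-sumOver (chainsFrom q m) _ _))
    where
    peel : ∀ {m} → m ≤ n → ∀ {c} → ChainFrom m c →
           chainWeight y (n V.∷ c) * ψ c ≈ (ιF (n C m) * pow (y zero) (n ∸ m)) * (chainWeight (V.tail y) c * ψ c)
    peel m≤n {c} (chainFrom ≡.refl _ exact) = trans (*-congʳ (chainWeight-∷ y n c m≤n exact)) (*-assoc _ _ _)

  Extensional : ∀ {n} → ((Fin n → ℕ) → Carrier) → Set ℓ
  Extensional φ = ∀ {u v} → u ≗ v → φ u ≈ φ v

  -- The multinomial recurrence: a chain from m+1 arises from a chain from m by raising one part νⱼ.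
  sumOver-chainsFrom-raise : ∀ q (y : Fin (suc q) → Carrier) (φ : (Fin (suc q) → ℕ) → Carrier) → Extensional φ → ∀ m →
    ∑[ c ∈ chainsFrom q (suc m) ] (chainWeight y c * φ c) ≈
    sum (λ j → y j * ∑[ c ∈ chainsFrom q m ] (chainWeight y c * φ (raiseUpTo j c)))
  sumOver-chainsFrom-raise zero y φ φ-ext m = begin
    chainWeight y c₁ * φ c₁ + 0#                          ≈⟨ +-congʳ (*-congʳ (chainWeight-single y (suc m))) ⟩
    (y zero * pow (y zero) m) * φ c₁ + 0#                 ≈⟨ solve 3 (λ y p f → (y :* p) :* f :+ :0 := y :* (p :* f :+ :0) :+ :0) refl (y zero) (pow (y zero) m) (φ c₁) ⟩
    y zero * (pow (y zero) m * φ c₁ + 0#) + 0#            ≈⟨ +-congʳ (*-congˡ (+-congʳ (*-cong (sym (chainWeight-single y m)) (φ-ext (λ { zero → ≡.refl }))))) ⟩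
    y zero * (chainWeight y c₀ * φ (raiseUpTo {0} zero c₀) + 0#) + 0# ∎
    where
    c₀ c₁ : Fin 1 → ℕ
    c₀ _ = m
    c₁ _ = suc m
  sumOver-chainsFrom-raise (suc q) y φ φ-ext m = sym (begin
    y zero * S₀ + sum (λ j → y' j * S' j)                   ≈⟨ +-cong (*-congˡ S₀≈) (sum-cong-≋ (λ j → *-congˡ {y' j} (S'≈ j))) ⟩
    y zero * sumN (suc m) (λ k → A m k * T k) + sum (λ j → y' j * sumN (suc m) (λ k → A m k * U j k))
                                                            ≈⟨ +-congˡ ΣU≈ΣT ⟩
    y zero * sumN (suc m) (λ k → A m k * T k) + sumN (suc m) (λ k → A m k * T (suc k))
                                                            ≈⟨ binomialTransform-suc m (y zero) T ⟨
    sumN (suc (suc m)) (λ k → A (suc m) k * T k)            ≈⟨ sumN-cong< (suc (suc m)) (λ k k<2+m → sumOver-chainsFrom-∷ y (suc m) k (ℕP.<⇒≤pred k<2+m) φ') ⟨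
    sumN (suc (suc m)) (λ k → ∑[ c ∈ chainsFrom q k ] (chainWeight y (suc m V.∷ c) * φ (suc m V.∷ c)))
                                                            ≈⟨ sumOver-chainsFrom-suc q (suc m) (λ c → chainWeight y c * φ c) ⟨
    ∑[ c ∈ chainsFrom (suc q) (suc m) ] (chainWeight y c * φ c) ∎)
    where
    y' : Fin (suc q) → Carrier
    y' = V.tail y
    φ' : (Fin (suc q) → ℕ) → Carrier
    φ' c = φ (suc m V.∷ c)
    φ'-ext : Extensional φ'
    φ'-ext c≗c' = φ-ext (λ { zero → ≡.refl ; (suc k) → c≗c' k })
    T : ℕ → Carrier
    T k = ∑[ c ∈ chainsFrom q k ] (chainWeight y' c * φ' c)
    U : Fin (suc q) → ℕ → Carrier
    U j k = ∑[ c ∈ chainsFrom q k ] (chainWeight y' c * φ' (raiseUpTo j c))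
    A : ℕ → ℕ → Carrier
    A n k = ιF (n C k) * pow (y zero) (n ∸ k)
    S₀ : Carrier
    S₀ = ∑[ c ∈ chainsFrom (suc q) m ] (chainWeight y c * φ (raiseUpTo {suc q} zero c))
    S' : Fin (suc q) → Carrier
    S' j = ∑[ c ∈ chainsFrom (suc q) m ] (chainWeight y c * φ (raiseUpTo (suc j) c))
    S₀≈ : S₀ ≈ sumN (suc m) (λ k → A m k * T k)
    S₀≈ = trans (sumOver-chainsFrom-suc q m _) (sumN-cong< (suc m) (λ k k<1+m → sumOver-chainsFrom-∷ y m k (ℕP.<⇒≤pred k<1+m) φ'))
    S'≈ : ∀ j → S' j ≈ sumN (suc m) (λ k → A m k * U j k)
    S'≈ j = trans (sumOver-chainsFrom-suc q m _) (sumN-cong< (suc m) (λ k k<1+m → sumOver-chainsFrom-∷ y m k (ℕP.<⇒≤pred k<1+m) (λ c → φ' (raiseUpTo j c))))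
    ΣU≈ΣT : sum (λ j → y' j * sumN (suc m) (λ k → A m k * U j k)) ≈ sumN (suc m) (λ k → A m k * T (suc k))
    ΣU≈ΣT = begin
      sum (λ j → y' j * sumN (suc m) (λ k → A m k * U j k))        ≈⟨ sum-cong-≋ (λ j → *-distribˡ-sumN (suc m) (y' j) (λ k → A m k * U j k)) ⟩
      sum (λ j → sumN (suc m) (λ k → y' j * (A m k * U j k)))      ≈⟨ sum-sumN-comm (suc m) (λ j k → y' j * (A m k * U j k)) ⟩
      sumN (suc m) (λ k → sum (λ j → y' j * (A m k * U j k)))      ≈⟨ sumN-cong< (suc m) (λ k _ → trans
          (sum-cong-≋ (λ j → solve 3 (λ y a u → y :* (a :* u) := a :* (y :* u)) refl (y' j) (A m k) (U j k)))
          (sym (*-distribˡ-sum {suc q} (A m k) (λ j → y' j * U j k)))) ⟩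
      sumN (suc m) (λ k → A m k * sum (λ j → y' j * U j k))        ≈⟨ sumN-cong< (suc m) (λ k _ → *-congˡ {A m k} (sumOver-chainsFrom-raise q y' φ' φ'-ext k)) ⟨
      sumN (suc m) (λ k → A m k * T (suc k))                       ∎

  Kernel : ℕ → Set c
  Kernel q = (Fin q → ℕ) → (Fin q → ℕ) → Carrier

  Extensional₂ : ∀ {q} → Kernel q → Set ℓ
  Extensional₂ g = ∀ {M M' N N'} → M ≗ M' → N ≗ N' → g M N ≈ g M' N'

  Msum Nsum : ∀ {q s} → (Fin s → Fin (suc q) → ℕ) → Fin q → ℕ
  Msum cs j = sumℕF (λ i → cs i (inject₁ j))
  Nsum cs j = sumℕF (λ i → nu (cs i) (inject₁ j))

  tupleWeight : ∀ {q s} → (Fin s → Fin (suc q) → Carrier) → (Fin s → Fin (suc q) → ℕ) → Carrier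
  tupleWeight Y cs = prodF (λ i → chainWeight (Y i) (cs i))

  -- cSeq t is cSeqWith (Den⁻¹ t) by definition; recursion on the rows (cSeqWith-∷) needs general kernels.
  cSeqWith : ∀ {q s} → Kernel q → (Fin s → Fin (suc q) → Carrier) → (Fin s → ℕ) → Carrier
  cSeqWith {q} {s} g Y ms = ∑[ cs ∈ chainTuples q s ms ] (tupleWeight Y cs * g (Msum cs) (Nsum cs))

  Den⁻¹ : ∀ {q} → (Fin q → Carrier) → Kernel q
  Den⁻¹ t M N = Den t M N ⁻¹

  _⊕_ : ∀ {q} → Kernel q → (Fin (suc q) → ℕ) → Kernel q
  (g ⊕ c) M N = g (λ k → c (inject₁ k) ℕ.+ M k) (λ k → nu c (inject₁ k) ℕ.+ N k)

  raiseKernel : ∀ {q} → Fin (suc q) → Kernel q → Kernel q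
  raiseKernel j g M N = g (raiseUpTo j M) (raiseAt j N)

  ⊕-extensional : ∀ {q} {g : Kernel q} → Extensional₂ g → ∀ c → Extensional₂ (g ⊕ c)
  ⊕-extensional g-ext c M≗M' N≗N' = g-ext (λ k → ≡.cong (c (inject₁ k) ℕ.+_) (M≗M' k)) (λ k → ≡.cong (nu c (inject₁ k) ℕ.+_) (N≗N' k))

  next-cong : ∀ {q} {c c' : Fin (suc q) → ℕ} → c ≗ c' → next c ≗ next c'
  next-cong {zero}  c≗c' zero    = ≡.refl
  next-cong {suc q} c≗c' zero    = c≗c' (suc zero)
  next-cong {suc q} c≗c' (suc k) = next-cong (λ k → c≗c' (suc k)) k

  nu-cong : ∀ {q} {c c' : Fin (suc q) → ℕ} → c ≗ c' → nu c ≗ nu c'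
  nu-cong c≗c' k = ≡.cong₂ ℕ._∸_ (c≗c' k) (next-cong c≗c' k)

  sumℕF-mono-≤ : ∀ {n} {f g : Fin n → ℕ} → Pointwise _≤_ f g → sumℕF f ≤ sumℕF g
  sumℕF-mono-≤ {zero}  f≤g = z≤n
  sumℕF-mono-≤ {suc n} f≤g = ℕP.+-mono-≤ (f≤g zero) (sumℕF-mono-≤ (λ i → f≤g (suc i)))

  Nsum≤Msum : ∀ {q s} (cs : Fin s → Fin (suc q) → ℕ) → Pointwise _≤_ (Nsum cs) (Msum cs)
  Nsum≤Msum cs k = sumℕF-mono-≤ (λ i → ℕP.m∸n≤m (cs i (inject₁ k)) (next (cs i) (inject₁ k)))

  chainTuples-cong : ∀ q s {ms ms' : Fin s → ℕ} → ms ≗ ms' → chainTuples q s ms ≡ chainTuples q s ms'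
  chainTuples-cong q zero    ms≗ms' = ≡.refl
  chainTuples-cong q (suc s) ms≗ms' = ≡.cong₂ (λ a b → concatMap (λ c → List.map (c V.∷_) b) (chainsFrom q a))
    (ms≗ms' zero) (chainTuples-cong q s (λ i → ms≗ms' (suc i)))

  prodF-cong : ∀ {n} {f g : Fin n → Carrier} → (∀ i → f i ≈ g i) → prodF f ≈ prodF g
  prodF-cong {zero}  f≈g = refl
  prodF-cong {suc n} f≈g = *-cong (f≈g zero) (prodF-cong (λ i → f≈g (suc i)))

  pow-cong : ∀ {x y} n → x ≈ y → pow x n ≈ pow y n
  pow-cong zero    x≈y = refl
  pow-cong (suc n) x≈y = *-cong x≈y (pow-cong n x≈y)

  cSeqWith-cong-ms : ∀ {q s} (g : Kernel q) Y {ms ms' : Fin s → ℕ} → ms ≗ ms' → cSeqWith g Y ms ≈ cSeqWith g Y ms'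
  cSeqWith-cong-ms {q} {s} g Y ms≗ms' = reflexive (≡.cong (λ L → sumOver L (λ cs → tupleWeight Y cs * g (Msum cs) (Nsum cs))) (chainTuples-cong q s ms≗ms'))

  cSeqWith-cong-Y : ∀ {q s} (g : Kernel q) {Y Y' : Fin s → Fin (suc q) → Carrier} → (∀ i j → Y i j ≈ Y' i j) → ∀ ms → cSeqWith g Y ms ≈ cSeqWith g Y' ms
  cSeqWith-cong-Y {q} {s} g Y≈Y' ms = sumOver-cong (chainTuples q s ms) (λ cs →
    *-congʳ (prodF-cong (λ i → *-congˡ (prodF-cong (λ j → pow-cong (nu (cs i) j) (Y≈Y' i j))))))

  cSeqWith-cong-g : ∀ {q s} {g g' : Kernel q} → (∀ M N → Pointwise _≤_ N M → g M N ≈ g' M N) → ∀ (Y : Fin s → Fin (suc q) → Carrier) ms → cSeqWith g Y ms ≈ cSeqWith g' Y ms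
  cSeqWith-cong-g {q} {s} g≈g' Y ms = sumOver-cong (chainTuples q s ms) (λ cs → *-congˡ (g≈g' _ _ (Nsum≤Msum cs)))

  cSeqWith-sum : ∀ {q s n} (G : Fin n → Kernel q) (Y : Fin s → Fin (suc q) → Carrier) ms →
                 cSeqWith (λ M N → sum (λ j → G j M N)) Y ms ≈ sum (λ j → cSeqWith (G j) Y ms)
  cSeqWith-sum {q} {s} G Y ms = trans
    (sumOver-cong (chainTuples q s ms) (λ cs → *-distribˡ-sum (tupleWeight Y cs) (λ j → G j (Msum cs) (Nsum cs))))
    (sym (sum-sumOver-comm (chainTuples q s ms) (λ j cs → tupleWeight Y cs * G j (Msum cs) (Nsum cs))))

  cSeqWith-∷ : ∀ {q s} (g : Kernel q) (Y : Fin (suc s) → Fin (suc q) → Carrier) ms →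
    cSeqWith g Y ms ≈ ∑[ c ∈ chainsFrom q (ms zero) ] (chainWeight (Y zero) c * cSeqWith (g ⊕ c) (V.tail Y) (V.tail ms))
  cSeqWith-∷ {q} {s} g Y ms = trans (sumOver-concatMap (chainsFrom q (ms zero)) (λ c → List.map (c V.∷_) T) term)
    (sumOver-cong (chainsFrom q (ms zero)) (λ c → trans (reflexive (sumOver-map T (c V.∷_) term))
      (trans (sumOver-cong T (λ cs → *-assoc _ _ _)) (sym (*-distribˡ-sumOver T _ _)))))
    where
    T : List (Fin s → Fin (suc q) → ℕ)
    T = chainTuples q s (V.tail ms)
    term : (Fin (suc s) → Fin (suc q) → ℕ) → Carrier
    term cs = tupleWeight Y cs * g (Msum cs) (Nsum cs)

  ⊕-raiseUpTo : ∀ {q} {g : Kernel q} → Extensional₂ g → ∀ j {c} → IsChain c → ∀ M N → (g ⊕ raiseUpTo j c) M N ≈ (raiseKernel j g ⊕ c) M N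
  ⊕-raiseUpTo g-ext j {c} chain M N = g-ext
    (λ k → ≡.trans (≡.cong (ℕ._+ M k) (raiseUpTo-inject₁ j c k)) (≡.sym (raiseUpTo-+ˡ j _ M k)))
    (λ k → ≡.trans (≡.cong (ℕ._+ N k) (nu-raiseUpTo j c chain k)) (≡.sym (raiseAt-+ˡ j _ N k)))

  raiseKernel-⊕ : ∀ {q} {g : Kernel q} → Extensional₂ g → ∀ j c M N → raiseKernel j (g ⊕ c) M N ≈ (raiseKernel j g ⊕ c) M N
  raiseKernel-⊕ g-ext j c M N = g-ext (λ k → ≡.sym (raiseUpTo-+ʳ j _ M k)) (λ k → ≡.sym (raiseAt-+ʳ j _ N k))

  cSeqWith-raise : ∀ {q} s (i : Fin s) (g : Kernel q) → Extensional₂ g → ∀ (Y : Fin s → Fin (suc q) → Carrier) ms →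
    cSeqWith g Y (V.updateAt ms i suc) ≈ sum (λ j → Y i j * cSeqWith (raiseKernel j g) Y ms)
  cSeqWith-raise {q} (suc s) zero g g-ext Y ms = begin
    cSeqWith g Y (V.updateAt ms zero suc)                                     ≈⟨ cSeqWith-∷ g Y (V.updateAt ms zero suc) ⟩
    ∑[ c ∈ chainsFrom q (suc (ms zero)) ] (chainWeight (Y zero) c * ψ c)      ≈⟨ sumOver-chainsFrom-raise q (Y zero) ψ ψ-ext (ms zero) ⟩
    sum (λ j → Y zero j * ∑[ c ∈ Cs ] (chainWeight (Y zero) c * ψ (raiseUpTo j c)))
      ≈⟨ sum-cong-≋ (λ j → *-congˡ {Y zero j} (sumOver-congᴬ (All.map (λ {c} chain-c → *-congˡ {chainWeight (Y zero) c} (raise≈ j (ChainFrom.isChain chain-c))) (chainsFrom-chains q (ms zero))))) ⟩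
    sum (λ j → Y zero j * ∑[ c ∈ Cs ] (chainWeight (Y zero) c * cSeqWith (raiseKernel j g ⊕ c) Y' ms'))
      ≈⟨ sum-cong-≋ (λ j → *-congˡ {Y zero j} (sym (cSeqWith-∷ (raiseKernel j g) Y ms))) ⟩
    sum (λ j → Y zero j * cSeqWith (raiseKernel j g) Y ms)                    ∎
    where
    Y' : Fin s → Fin (suc q) → Carrier
    Y' = V.tail Y
    ms' : Fin s → ℕ
    ms' = V.tail ms
    Cs : List (Fin (suc q) → ℕ)
    Cs = chainsFrom q (ms zero)
    ψ : (Fin (suc q) → ℕ) → Carrier
    ψ c = cSeqWith (g ⊕ c) Y' ms'
    ψ-ext : Extensional ψ
    ψ-ext c≗c' = cSeqWith-cong-g (λ M N _ → g-ext (λ k → ≡.cong (ℕ._+ M k) (c≗c' (inject₁ k))) (λ k → ≡.cong (ℕ._+ N k) (nu-cong c≗c' (inject₁ k)))) Y' ms'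
    raise≈ : ∀ j {c} → IsChain c → ψ (raiseUpTo j c) ≈ cSeqWith (raiseKernel j g ⊕ c) Y' ms'
    raise≈ j chain = cSeqWith-cong-g (λ M N _ → ⊕-raiseUpTo g-ext j chain M N) Y' ms'
  cSeqWith-raise {q} (suc s) (suc i) g g-ext Y ms = begin
    cSeqWith g Y (V.updateAt ms (suc i) suc)                                  ≈⟨ cSeqWith-∷ g Y (V.updateAt ms (suc i) suc) ⟩
    ∑[ c ∈ Cs ] (chainWeight (Y zero) c * cSeqWith (g ⊕ c) Y' (V.updateAt ms' i suc))
      ≈⟨ sumOver-cong Cs (λ c → *-congˡ {chainWeight (Y zero) c} (cSeqWith-raise s i (g ⊕ c) (⊕-extensional g-ext c) Y' ms')) ⟩
    ∑[ c ∈ Cs ] (chainWeight (Y zero) c * sum (λ j → Y' i j * cSeqWith (raiseKernel j (g ⊕ c)) Y' ms'))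
      ≈⟨ sumOver-cong Cs (λ c → *-congˡ {chainWeight (Y zero) c} (sum-cong-≋ (λ j → *-congˡ {Y' i j} (cSeqWith-cong-g (λ M N _ → raiseKernel-⊕ g-ext j c M N) Y' ms')))) ⟩
    ∑[ c ∈ Cs ] (chainWeight (Y zero) c * sum (λ j → Y' i j * H j c))
      ≈⟨ sumOver-cong Cs (λ c → trans (*-distribˡ-sum (chainWeight (Y zero) c) (λ j → Y' i j * H j c))
           (sum-cong-≋ (λ j → solve 3 (λ w y h → w :* (y :* h) := y :* (w :* h)) refl (chainWeight (Y zero) c) (Y' i j) (H j c)))) ⟩
    ∑[ c ∈ Cs ] sum (λ j → Y' i j * (chainWeight (Y zero) c * H j c))        ≈⟨ sum-sumOver-comm Cs (λ j c → Y' i j * (chainWeight (Y zero) c * H j c)) ⟨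
    sum (λ j → ∑[ c ∈ Cs ] (Y' i j * (chainWeight (Y zero) c * H j c)))      ≈⟨ sum-cong-≋ (λ j → *-distribˡ-sumOver Cs (Y' i j) (λ c → chainWeight (Y zero) c * H j c)) ⟨
    sum (λ j → Y' i j * ∑[ c ∈ Cs ] (chainWeight (Y zero) c * H j c))        ≈⟨ sum-cong-≋ (λ j → *-congˡ {Y' i j} (cSeqWith-∷ (raiseKernel j g) Y ms)) ⟨
    sum (λ j → Y (suc i) j * cSeqWith (raiseKernel j g) Y ms)                ∎
    where
    Y' : Fin s → Fin (suc q) → Carrier
    Y' = V.tail Y
    ms' : Fin s → ℕ
    ms' = V.tail ms
    Cs : List (Fin (suc q) → ℕ)
    Cs = chainsFrom q (ms zero)
    H : Fin (suc q) → (Fin (suc q) → ℕ) → Carrier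
    H j c = cSeqWith (raiseKernel j g ⊕ c) Y' ms'

  prodF-≗ : ∀ {n} {f g : Fin n → Carrier} → f ≗ g → prodF f ≡ prodF g
  prodF-≗ {zero}  f≗g = ≡.refl
  prodF-≗ {suc n} f≗g = ≡.cong₂ _*_ (f≗g zero) (prodF-≗ (λ i → f≗g (suc i)))

  Den⁻¹-extensional : ∀ {q} (t : Fin q → Carrier) → Extensional₂ (Den⁻¹ t)
  Den⁻¹-extensional t M≗M' N≗N' = reflexive (≡.cong _⁻¹ (prodF-≗ (λ j → ≡.cong₂ (den (t j)) (M≗M' j) (N≗N' j))))

  cSeq-split : ∀ {q s} (t : Fin q → Carrier) → AvoidsNonPositiveIntegers t → (Y : Fin s → Fin (suc q) → Carrier) (i i' : Fin s) →
    (∀ j → Y i j + Y i' j ≈ 1#) → ∀ ms → cSeq t Y ms ≈ cSeq t Y (V.updateAt ms i suc) + cSeq t Y (V.updateAt ms i' suc)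
  cSeq-split {q} {s} t t-free Y i i' Yi+Yi'≈1 ms = sym (begin
    cSeqWith (Den⁻¹ t) Y (V.updateAt ms i suc) + cSeqWith (Den⁻¹ t) Y (V.updateAt ms i' suc)
      ≈⟨ +-cong (cSeqWith-raise s i (Den⁻¹ t) (Den⁻¹-extensional t) Y ms) (cSeqWith-raise s i' (Den⁻¹ t) (Den⁻¹-extensional t) Y ms) ⟩
    sum (λ j → Y i j * G j) + sum (λ j → Y i' j * G j)  ≈⟨ ∑-distrib-+ (λ j → Y i j * G j) (λ j → Y i' j * G j) ⟨
    sum (λ j → Y i j * G j + Y i' j * G j)              ≈⟨ sum-cong-≋ (λ j → trans (sym (distribʳ (G j) _ _)) (trans (*-congʳ (Yi+Yi'≈1 j)) (*-identityˡ _))) ⟩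
    sum G                                               ≈⟨ cSeqWith-sum (λ j → raiseKernel j (Den⁻¹ t)) Y ms ⟨
    cSeqWith (λ M N → sum (λ j → raiseKernel j (Den⁻¹ t) M N)) Y ms ≈⟨ cSeqWith-cong-g (λ M N N≤M → Den⁻¹-split t t-free M N N≤M) Y ms ⟩
    cSeqWith (Den⁻¹ t) Y ms                             ∎)
    where
    G : Fin (suc q) → Carrier
    G j = cSeqWith (raiseKernel j (Den⁻¹ t)) Y ms

  prodF≈1 : ∀ {n} {f : Fin n → Carrier} → (∀ j → f j ≈ 1#) → prodF f ≈ 1#
  prodF≈1 {zero}  f≈1 = refl
  prodF≈1 {suc n} f≈1 = trans (*-cong (f≈1 zero) (prodF≈1 (λ j → f≈1 (suc j)))) (*-identityˡ 1#)

  prodℕ≡1 : ∀ {n} {f : Fin n → ℕ} → (∀ j → f j ≡ 1) → prodℕ f ≡ 1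
  prodℕ≡1 {zero}  f≡1 = ≡.refl
  prodℕ≡1 {suc n} f≡1 = ≡.cong₂ ℕ._*_ (f≡1 zero) (prodℕ≡1 (λ j → f≡1 (suc j)))

  sumℕF≡0 : ∀ {n} {f : Fin n → ℕ} → (∀ j → f j ≡ 0) → sumℕF f ≡ 0
  sumℕF≡0 {zero}  f≡0 = ≡.refl
  sumℕF≡0 {suc n} f≡0 = ≡.cong₂ ℕ._+_ (f≡0 zero) (sumℕF≡0 (λ j → f≡0 (suc j)))

  nu≗0 : ∀ {q} (c : Fin (suc q) → ℕ) → c ≗ (λ _ → 0) → nu c ≗ (λ _ → 0)
  nu≗0 c c≗0 k = ≡.trans (≡.cong (ℕ._∸ next c k) (c≗0 k)) (ℕP.0∸n≡0 (next c k))

  chainWeight≈1 : ∀ {q} (y : Fin (suc q) → Carrier) c → c ≗ (λ _ → 0) → chainWeight y c ≈ 1#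
  chainWeight≈1 y c c≗0 = begin
    ιF (multinomial (c zero) (nu c)) * prodF (λ j → pow (y j) (nu c j))  ≈⟨ *-cong (reflexive (≡.cong ιF multinomial≡1′)) (prodF≈1 (λ j → reflexive (≡.cong (pow (y j)) (nu≗0 c c≗0 j)))) ⟩
    ιF 1 * 1#                                                            ≈⟨ trans (*-identityʳ _) (+-identityʳ 1#) ⟩
    1#                                                                   ∎
    where
    multinomial≡1′ : multinomial (c zero) (nu c) ≡ 1
    multinomial≡1′ = multinomial≡1 (c zero) (nu c) (≡.trans (prodℕ≡1 (λ j → ≡.cong _! (nu≗0 c c≗0 j))) (≡.cong _! (≡.sym (c≗0 zero))))

  cSeqWith-++-zeros : ∀ {q} s₁ {s₂} (g : Kernel q) → Extensional₂ g → (Y₁ : Fin s₁ → Fin (suc q) → Carrier) (Y₂ : Fin s₂ → Fin (suc q) → Carrier) (ms : Fin s₁ → ℕ) →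
                      cSeqWith g (Y₁ ++ Y₂) (ms ++ (λ _ → 0)) ≈ cSeqWith g Y₁ ms
  cSeqWith-++-zeros {q} zero {s₂} g g-ext Y₁ Y₂ ms = begin
    cSeqWith g Y₂ (λ _ → 0)                                  ≡⟨ ≡.cong (λ cs → sumOver cs term) (chainTuples-zeros q s₂ (λ _ → 0) (λ _ → ≡.refl)) ⟩
    term (zeroTuple q s₂) + 0#                               ≈⟨ +-congʳ (*-cong (prodF≈1 (λ i → chainWeight≈1 (Y₂ i) _ (zeroTuple≗0 q s₂ i)))
                                                                  (g-ext (λ k → sumℕF≡0 (λ i → zeroTuple≗0 q s₂ i (inject₁ k))) (λ k → sumℕF≡0 (λ i → nu≗0 _ (zeroTuple≗0 q s₂ i) (inject₁ k))))) ⟩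
    1# * g (λ _ → 0) (λ _ → 0) + 0#                          ∎
    where
    term : (Fin s₂ → Fin (suc q) → ℕ) → Carrier
    term cs = tupleWeight Y₂ cs * g (Msum cs) (Nsum cs)
  cSeqWith-++-zeros {q} (suc s₁) {s₂} g g-ext Y₁ Y₂ ms = begin
    cSeqWith g (Y₁ ++ Y₂) (ms ++ (λ _ → 0))                  ≈⟨ cSeqWith-∷ g (Y₁ ++ Y₂) (ms ++ (λ _ → 0)) ⟩
    ∑[ c ∈ Cs ] (chainWeight (Y₁ zero) c * cSeqWith (g ⊕ c) (V.tail (Y₁ ++ Y₂)) (V.tail (ms ++ (λ _ → 0))))
      ≈⟨ sumOver-cong Cs (λ c → *-congˡ (tails≈ c)) ⟩
    ∑[ c ∈ Cs ] (chainWeight (Y₁ zero) c * cSeqWith (g ⊕ c) (V.tail Y₁) (V.tail ms))    ≈⟨ cSeqWith-∷ g Y₁ ms ⟨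
    cSeqWith g Y₁ ms                                         ∎
    where
    Cs : List (Fin (suc q) → ℕ)
    Cs = chainsFrom q (ms zero)
    tails≈ : ∀ c → cSeqWith (g ⊕ c) (V.tail (Y₁ ++ Y₂)) (V.tail (ms ++ (λ _ → 0))) ≈ cSeqWith (g ⊕ c) (V.tail Y₁) (V.tail ms)
    tails≈ c = begin
      cSeqWith (g ⊕ c) (V.tail (Y₁ ++ Y₂)) (V.tail (ms ++ (λ _ → 0)))  ≈⟨ cSeqWith-cong-Y (g ⊕ c) (λ i j → reflexive (≡.cong (λ f → f j) (tail-++ Y₁ Y₂ i))) _ ⟩
      cSeqWith (g ⊕ c) (V.tail Y₁ ++ Y₂) (V.tail (ms ++ (λ _ → 0)))    ≈⟨ cSeqWith-cong-ms (g ⊕ c) (V.tail Y₁ ++ Y₂) (tail-++ ms (λ _ → 0)) ⟩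
      cSeqWith (g ⊕ c) (V.tail Y₁ ++ Y₂) (V.tail ms ++ (λ _ → 0))      ≈⟨ cSeqWith-++-zeros s₁ (g ⊕ c) (⊕-extensional g-ext c) (V.tail Y₁) Y₂ (V.tail ms) ⟩
      cSeqWith (g ⊕ c) (V.tail Y₁) (V.tail ms)                         ∎

  module _ {r} (H : (Fin r → ℕ) → (Fin r → ℕ) → Carrier)
           (H-cong : ∀ n {K K'} → K ≗ K' → H n K ≈ H n K')
           (H-split : ∀ i n K → H n K ≈ H (V.updateAt n i suc) K + H n (V.updateAt K i suc)) where

    iter-Δ : ∀ i c K (a : (Fin r → ℕ) → Carrier) → (∀ n → a n ≈ H n K) →
             ∀ n → iter (Δ i) c a n ≈ H n (iter (λ K → V.updateAt K i suc) c K)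
    iter-Δ i zero    K a a≈H n = a≈H n
    iter-Δ i (suc c) K a a≈H n = begin
      iter (Δ i) c a n - iter (Δ i) c a (V.updateAt n i suc)               ≈⟨ +-cong (iter-Δ i c K a a≈H n) (-‿cong (iter-Δ i c K a a≈H (V.updateAt n i suc))) ⟩
      H n Kc - H (V.updateAt n i suc) Kc                                    ≈⟨ +-congʳ (H-split i n Kc) ⟩
      (H (V.updateAt n i suc) Kc + H n (V.updateAt Kc i suc)) - H (V.updateAt n i suc) Kc
                                                                            ≈⟨ solve 2 (λ a b → (a :+ b) :- a := b) refl (H (V.updateAt n i suc) Kc) (H n (V.updateAt Kc i suc)) ⟩
      H n (V.updateAt Kc i suc)                                             ∎
      where
      Kc : Fin r → ℕ
      Kc = iter (λ K → V.updateAt K i suc) c K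

    Δ-fold : ∀ m (is : Fin m → Fin r) (ks : Fin m → ℕ) K (a : (Fin r → ℕ) → Carrier) → (∀ n → a n ≈ H n K) →
             ∀ n → V.foldr (λ f g → f ∘ g) id (λ l → iter (Δ (is l)) (ks l)) a n ≈ H n (λ l → K l ℕ.+ sumᴺ (λ l' → pointMass (is l') (ks l') l))
    Δ-fold zero    is ks K a a≈H n = trans (a≈H n) (H-cong n (λ l → ≡.sym (ℕP.+-identityʳ (K l))))
    Δ-fold (suc m) is ks K a a≈H n = trans (iter-Δ (is zero) (ks zero) K' _ (Δ-fold m (is ∘ suc) (ks ∘ suc) K a a≈H) n) (H-cong n K'-raised)
      where
      K' : Fin r → ℕ
      K' l = K l ℕ.+ sumᴺ (λ l' → pointMass (is (suc l')) (ks (suc l')) l)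
      K'-raised : ∀ l → iter (λ K → V.updateAt K (is zero) suc) (ks zero) K' l ≡ K l ℕ.+ sumᴺ (λ l' → pointMass (is l') (ks l') l)
      K'-raised l = ≡.trans (iter-updateAt-suc (is zero) (ks zero) K' l) (a+b+c≡a+[c+b] (K l) _ _)
        where
        a+b+c≡a+[c+b] : ∀ a b c → (a ℕ.+ b) ℕ.+ c ≡ a ℕ.+ (c ℕ.+ b)
        a+b+c≡a+[c+b] a b c = ≡.trans (ℕP.+-assoc a b c) (≡.cong (a ℕ.+_) (ℕP.+-comm b c))

    Δs-from-split : ∀ (a : (Fin r → ℕ) → Carrier) → (∀ n → a n ≈ H n (λ _ → 0)) → ∀ k n → Δs k a n ≈ H n k
    Δs-from-split a a≈H k n = trans (Δ-fold r id k (λ _ → 0) a a≈H n) (H-cong n (sum-pointMass k))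

  Δs-cSeq≈cSeq-oneMinus : ∀ (r q : ℕ) (x : Fin r → Fin (suc q) → Carrier) (t : Fin q → Carrier) → AvoidsNonPositiveIntegers t →
            (n k : Fin r → ℕ) → Δs k (cSeq t x) n ≈ cSeq t (x ++ (λ i → oneMinus (x i))) (n ++ k)
  Δs-cSeq≈cSeq-oneMinus r q x t t-free n k =
    Δs-from-split H H-cong H-split (cSeq t x) (λ n → sym (cSeqWith-++-zeros r (Den⁻¹ t) (Den⁻¹-extensional t) x y n)) k n
    where
    y : Fin r → Fin (suc q) → Carrier
    y i = oneMinus (x i)
    Z : Fin (r ℕ.+ r) → Fin (suc q) → Carrier
    Z = x ++ y
    H : (Fin r → ℕ) → (Fin r → ℕ) → Carrier
    H n K = cSeq t Z (n ++ K)
    H-cong : ∀ n {K K'} → K ≗ K' → H n K ≈ H n K'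
    H-cong n K≗K' = cSeqWith-cong-ms (Den⁻¹ t) Z (++-cong n n (λ _ → ≡.refl) K≗K')
    Z-complementary : ∀ i j → Z (i ↑ˡ r) j + Z (r ↑ʳ i) j ≈ 1#
    Z-complementary i j = begin
      Z (i ↑ˡ r) j + Z (r ↑ʳ i) j ≡⟨ ≡.cong₂ (λ f h → f j + h j) (lookup-++ˡ x y i) (lookup-++ʳ x y i) ⟩
      x i j + (1# - x i j)        ≈⟨ solve 1 (λ a → a :+ (:1 :- a) := :1) refl (x i j) ⟩
      1#                          ∎
    H-split : ∀ i n K → H n K ≈ H (V.updateAt n i suc) K + H n (V.updateAt K i suc)
    H-split i n K = begin
      H n K                  ≈⟨ cSeq-split t t-free Z (i ↑ˡ r) (r ↑ʳ i) (Z-complementary i) (n ++ K) ⟩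
      cSeq t Z (V.updateAt (n ++ K) (i ↑ˡ r) suc) + cSeq t Z (V.updateAt (n ++ K) (r ↑ʳ i) suc)
                             ≈⟨ +-cong (cSeqWith-cong-ms (Den⁻¹ t) Z (≡.sym ∘ updateAt-++ˡ r n K i)) (cSeqWith-cong-ms (Den⁻¹ t) Z (≡.sym ∘ updateAt-++ʳ r n K i)) ⟩
      H (V.updateAt n i suc) K + H n (V.updateAt K i suc) ∎

corollary4p3 : ∀ {c ℓ} (F : CharZeroField c ℓ) → let open CharZeroField F in let open FieldDefs F in
    (r q : ℕ) → 1 ≤ r →
    (x : Fin r → Fin (suc q) → Carrier) →
    (t : Fin q → Carrier) → (∀ j (m : ℕ) → ¬ (t j ≈ - ιF m)) →
    (n k : Fin r → ℕ) →
    Δs k (cSeq t x) n ≈ cSeq t (x ++ (λ i → oneMinus (x i))) (n ++ k)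
corollary4p3 F r q _ x t t-free n k = Δs-cSeq≈cSeq-oneMinus F r q x t t-free n k
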